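{- Let $r\geq 3$. Let $\mathcal{G}$ be the edge-labelled graph on the $2r$ vertices $u_1,\dots,u_{r+1}$ and $w_1,\dots,w_{r-1}$ with the following edges: $\{u_j,u_{j+1}\}$ of label $j-1$ for $j=1,\dots,r$ (labels $0,\dots,r-1$); $\{w_j,w_{j+1}\}$ of label $j-1$ for $j=1,\dots,r-2$ (labels $0,\dots,r-3$); and $\{u_j,w_j\}$ of label $r-1$ for $j=1,\dots,r-1$. Then $\mathcal{G}$ is a CPR graph and the group it represents is isomorphic to the wreath product $S_r\wr C_2$.
   Context: A string C-group of rank $r$ is a group $G$ with an ordered sequence $(\rho_0,\dots,\rho_{r-1})$ of involutions generating $G$ such that $(\rho_i\rho_j)^2=1$ whenever $|i-j|\geq2$ and $\langle \rho_i : i\in I\rangle\cap\langle\rho_j : j\in J\rangle=\langle \rho_k : k\in I\cap J\rangle$ for all $I,J\subseteq\{0,\dots,r-1\}$. An edge-labelled multigraph on a finite set $\Omega$ with labels $0,\dots,r-1$, in which each vertex lies on at most one edge of each label and each label occurs, determines involutions $\rho_l\in\mathrm{Sym}(\Omega)$, $\rho_l$ being the product of the transpositions $(a\,b)$ over the edges $\{a,b\}$ of label $l$; the group it represents is $\langle\rho_0,\dots,\rho_{r-1}\rangle$, and the graph is a CPR graph if this group with generating sequence $(\rho_0,\dots,\rho_{r-1})$ is a string C-group. -}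

module Defs where

open import Data.Nat using (ℕ; zero; suc; _+_; _*_; _∸_; _<?_)
open import Data.Fin using (Fin; toℕ; fromℕ<)
open import Data.Fin.Subset using (Subset; _∈_; _∩_)
open import Data.Fin.Permutation using (Permutation′; _⟨$⟩ʳ_; _∘ₚ_; transpose; flip)
  renaming (id to idₚ)
open import Data.Bool using (Bool; true; false; if_then_else_; _xor_)
open import Data.List using (List; []; _∷_; map; upTo; foldr; _++_)
open import Data.Maybe using (Maybe; just; nothing)
open import Data.Product using (_×_; _,_; Σ; ∃)
open import Relation.Binary.PropositionalEquality using (_≡_)
open import Relation.Nullary using (¬_; yes; no)

Perm : ℕ → Set
Perm = Permutation′

infix 4 _≈ₚ_
_≈ₚ_ : ∀ {n} → Perm n → Perm n → Set
π ≈ₚ σ = ∀ i → π ⟨$⟩ʳ i ≡ σ ⟨$⟩ʳ i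

data ⟨_∣_⟩∋_ {n r : ℕ} (ρ : Fin r → Perm n) (I : Subset r) : Perm n → Set where
  gen-id  : ⟨ ρ ∣ I ⟩∋ idₚ
  gen-gen : ∀ i → i ∈ I → ⟨ ρ ∣ I ⟩∋ ρ i
  gen-inv : ∀ {π} → ⟨ ρ ∣ I ⟩∋ π → ⟨ ρ ∣ I ⟩∋ flip π
  gen-mul : ∀ {π σ} → ⟨ ρ ∣ I ⟩∋ π → ⟨ ρ ∣ I ⟩∋ σ → ⟨ ρ ∣ I ⟩∋ (π ∘ₚ σ)
  gen-ext : ∀ {π σ} → π ≈ₚ σ → ⟨ ρ ∣ I ⟩∋ π → ⟨ ρ ∣ I ⟩∋ σ

open import Data.Fin.Subset using (⊤)

_∈G⟨_⟩ : ∀ {n r} → Perm n → (Fin r → Perm n) → Set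
π ∈G⟨ ρ ⟩ = ⟨ ρ ∣ ⊤ ⟩∋ π

IsInvolution : ∀ {n} → Perm n → Set
IsInvolution π = (π ∘ₚ π ≈ₚ idₚ) × ¬ (π ≈ₚ idₚ)

record IsStringCGroup {n r : ℕ} (ρ : Fin r → Perm n) : Set where
  field
    involutions  : ∀ i → IsInvolution (ρ i)
    string       : ∀ i j → 2 Data.Nat.≤ (toℕ i ∸ toℕ j) + (toℕ j ∸ toℕ i) →
                   (ρ i ∘ₚ ρ j) ∘ₚ (ρ i ∘ₚ ρ j) ≈ₚ idₚ
    intersection : ∀ (I J : Subset r) (π : Perm n) →
                   ⟨ ρ ∣ I ⟩∋ π × ⟨ ρ ∣ J ⟩∋ π → ⟨ ρ ∣ I ∩ J ⟩∋ π
    intersection⁻ : ∀ (I J : Subset r) (π : Perm n) →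
                   ⟨ ρ ∣ I ∩ J ⟩∋ π → ⟨ ρ ∣ I ⟩∋ π × ⟨ ρ ∣ J ⟩∋ π

LGraph : ℕ → ℕ → Set
LGraph n r = List (Fin r × Fin n × Fin n)

edgeInvolution : ∀ {n r} → LGraph n r → Fin r → Perm n
edgeInvolution [] l = idₚ
edgeInvolution ((l′ , a , b) ∷ es) l with toℕ l′ Data.Nat.≟ toℕ l
... | yes _ = transpose a b ∘ₚ edgeInvolution es l
... | no  _ = edgeInvolution es l

IsCPRGraph : ∀ {n r} → LGraph n r → Set
IsCPRGraph 𝒢 = IsStringCGroup (edgeInvolution 𝒢)

-- Vertices are numbered 0,…,2r-1:
--   u_j ↦ j - 1          (j = 1,…,r+1)
--   w_j ↦ r + j          (j = 1,…,r-1)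
-- Edges are first listed as triples of natural numbers, then converted
-- (every entry is in range, so nothing is dropped).

toFin? : ∀ {m} → ℕ → Maybe (Fin m)
toFin? {m} k with k <? m
... | yes k<m = just (fromℕ< k<m)
... | no  _   = nothing

mkEdges : ∀ {n r} → List (ℕ × ℕ × ℕ) → LGraph n r
mkEdges [] = []
mkEdges ((l , a , b) ∷ es) with toFin? l | toFin? a | toFin? b
... | just l′ | just a′ | just b′ = (l′ , a′ , b′) ∷ mkEdges es
... | _       | _       | _       = mkEdges es

uV : ℕ → ℕ → ℕ
uV r j = j ∸ 1

wV : ℕ → ℕ → ℕ
wV r j = r + j

graphEdgesℕ : ℕ → List (ℕ × ℕ × ℕ)
graphEdgesℕ r =
     map (λ k → let j = suc k in (j ∸ 1 , uV r j , uV r (suc j))) (upTo r)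
  ++ map (λ k → let j = suc k in (j ∸ 1 , wV r j , wV r (suc j))) (upTo (r ∸ 2))
  ++ map (λ k → let j = suc k in (r ∸ 1 , uV r j , wV r j)) (upTo (r ∸ 1))

𝒢 : (r : ℕ) → LGraph (2 * r) r
𝒢 r = mkEdges (graphEdgesℕ r)

-- The wreath product S_r ≀ C_2 = (S_r × S_r) ⋊ C_2, C_2 = Bool under xor,
-- the nontrivial element swapping the two coordinates.

Wr : ℕ → Set
Wr r = Perm r × Perm r × Bool

infix 4 _≈W_
_≈W_ : ∀ {r} → Wr r → Wr r → Set
(a , b , s) ≈W (c , d , t) = (a ≈ₚ c) × (b ≈ₚ d) × (s ≡ t)

swapIf : ∀ {r} → Bool → Perm r × Perm r → Perm r × Perm r
swapIf false (c , d) = (c , d)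
swapIf true  (c , d) = (d , c)

infixl 7 _·W_
_·W_ : ∀ {r} → Wr r → Wr r → Wr r
(a , b , s) ·W (c , d , t) with swapIf s (c , d)
... | (c′ , d′) = (a ∘ₚ c′ , b ∘ₚ d′ , s xor t)

record WreathIso {n k : ℕ} (r : ℕ) (ρ : Fin k → Perm n) : Set where
  field
    φ        : Wr r → Perm n
    φ-into   : ∀ x → φ x ∈G⟨ ρ ⟩
    φ-hom    : ∀ x y → φ (x ·W y) ≈ₚ φ x ∘ₚ φ y
    φ-inj    : ∀ x y → φ x ≈ₚ φ y → x ≈W y
    φ-onto   : ∀ π → π ∈G⟨ ρ ⟩ → Σ (Wr r) (λ x → φ x ≈ₚ π)

module Submission where

-- Number the 2r vertices as two copies of {0,…,r-1}: u_1,…,u_r are (p , false) and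
-- w_1,…,w_{r-1},u_{r+1} are (p , true). Then ρ_{r-1} exchanges the copies, ρ_{r-2} is the
-- adjacent transposition s_{r-2} on the first copy only, and ρ_l (l < r-2) is s_l on both
-- copies, so the graph represents the image of a faithful action of S_r ≀ C_2 on the two
-- copies. For the intersection property the subgroup generated by the ρ_i with i ∈ I is
-- described explicitly: (a , b , s) lies in it iff for every label i < r-1 outside I both
-- a and b preserve {0,…,i} and agree on it, and, if r-1 ∉ I, s is trivial and b fixes r-1.
-- These conditions are plainly closed under intersection. Every word in the generators
-- satisfies them, and conversely (a , b , 0) = (a ∘ b⁻¹ , 1 , 0) · (b , b , 0), where each
-- factor lies in a Young subgroup generated by the adjacent transpositions available in I.
-- Taking I to be all labels shows that the action is onto S_r ≀ C_2.

open import Defs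
open import Data.Nat as ℕ using (ℕ; zero; suc; _+_; _*_; _∸_; _≤_; _<_; z≤n; s≤s)
open import Data.Nat.Properties as ℕ using ()
open import Data.Fin using (Fin; toℕ; fromℕ; fromℕ<; inject₁) renaming (zero to fzero; suc to fsuc)
open import Data.Fin.Properties
  using (_≟_; toℕ-injective; toℕ-fromℕ<; toℕ-fromℕ; toℕ<n; toℕ-inject₁; all?; ¬∀⟶∃¬)
open import Data.Fin.Relation.Unary.Top using (View; view; ‵fromℕ; ‵inj₁; ‵inject₁; view-fromℕ; view-inject₁)
open import Data.Fin.Subset using (Subset; _∈_; _∉_; _∩_; _⊆_; ⊤)
open import Data.Fin.Subset.Properties using (_∈?_; ∈⊤; x∈p∩q⁺; p∩q⊆p; p∩q⊆q)
open import Data.Fin.Permutation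
  using (_⟨$⟩ʳ_; _⟨$⟩ˡ_; _∘ₚ_; flip; transpose; permutation; inverseˡ; inverseʳ; lift₀; remove;
         lift₀-id; lift₀-comp; lift₀-cong; lift₀-transpose; lift₀-remove)
  renaming (id to idₚ)
open import Data.Bool using (Bool; true; false; if_then_else_; _xor_)
open import Data.List using (List; []; _∷_; [_]; map; upTo; foldl; _++_)
open import Data.List.Properties using (foldl-++; map-++; upTo-∷ʳ)
open import Data.List.Relation.Unary.All using (All; []; _∷_)
import Data.List.Relation.Unary.All.Properties as All
open import Data.Maybe using (just)
open import Data.Product using (_×_; _,_; Σ; proj₁; proj₂)
open import Data.Sum using (_⊎_; inj₁; inj₂; [_,_]′)
open import Data.Empty using (⊥-elim)
open import Function using (_∘_; _∘′_; id; case_of_; _⇔_; mk⇔)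
open Function.Equivalence using (to; from)
open import Relation.Binary.PropositionalEquality
  using (_≡_; _≢_; refl; sym; trans; cong; cong₂; subst; subst₂; ≢-sym; module ≡-Reasoning)
open import Relation.Binary.Definitions using (DecidableEquality; tri<; tri≈; tri>)
open import Relation.Nullary using (¬_; Dec; yes; no; does)
open import Relation.Nullary.Decidable using (dec-true; dec-false; _×-dec_; _→-dec_)
open import Relation.Unary using (Decidable)

data Position {A : Set} (i j x : A) : Set where
  at-left   : x ≡ i → Position i j x
  at-right  : x ≢ i → x ≡ j → Position i j x
  elsewhere : x ≢ i → x ≢ j → Position i j x

position : ∀ {A : Set} → DecidableEquality A → ∀ i j x → Position i j x
position _≟_ i j x with x ≟ i | x ≟ j
... | yes x≡i | _ = at-left x≡i
... | no x≢i | yes x≡j = at-right x≢i x≡j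
... | no x≢i | no x≢j = elsewhere x≢i x≢j

module _ {n : ℕ} (i j : Fin n) where

  transpose-left : transpose i j ⟨$⟩ʳ i ≡ j
  transpose-left rewrite dec-true (i ≟ i) refl = refl

  transpose-right : transpose i j ⟨$⟩ʳ j ≡ i
  transpose-right with j ≟ i
  ... | yes j≡i = j≡i
  ... | no j≢i rewrite dec-true (j ≟ j) refl = refl

  transpose-other : ∀ {x} → x ≢ i → x ≢ j → transpose i j ⟨$⟩ʳ x ≡ x
  transpose-other {x} x≢i x≢j rewrite dec-false (x ≟ i) x≢i | dec-false (x ≟ j) x≢j = refl

module _ {n : ℕ} where

  open ≡-Reasoning

  private
    τ : Fin n → Fin n → Fin n → Fin n
    τ i j x = transpose i j ⟨$⟩ʳ x

  transpose-involutive : ∀ (i j x : Fin n) → τ i j (τ i j x) ≡ x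
  transpose-involutive i j x with position _≟_ i j x
  ... | at-left refl = trans (cong (τ x j) (transpose-left x j)) (transpose-right x j)
  ... | at-right _ refl = trans (cong (τ i x) (transpose-right i x)) (transpose-left i x)
  ... | elsewhere x≢i x≢j = trans (cong (τ i j) (transpose-other i j x≢i x≢j)) (transpose-other i j x≢i x≢j)

  transpose-sym : ∀ (i j x : Fin n) → τ i j x ≡ τ j i x
  transpose-sym i j x with position _≟_ i j x
  ... | at-left refl = trans (transpose-left x j) (sym (transpose-right j x))
  ... | at-right _ refl = trans (transpose-right i x) (sym (transpose-left x i))
  ... | elsewhere x≢i x≢j = trans (transpose-other i j x≢i x≢j) (sym (transpose-other j i x≢j x≢i))

  transpose-conjugate : ∀ {i j k : Fin n} → i ≢ j → j ≢ k → i ≢ k →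
                        ∀ x → τ i j (τ j k (τ i j x)) ≡ τ i k x
  transpose-conjugate {i} {j} {k} i≢j j≢k i≢k x with position _≟_ i j x
  ... | at-left refl = begin
    τ x j (τ j k (τ x j x)) ≡⟨ cong (λ y → τ x j (τ j k y)) (transpose-left x j) ⟩
    τ x j (τ j k j)         ≡⟨ cong (τ x j) (transpose-left j k) ⟩
    τ x j k                 ≡⟨ transpose-other x j (≢-sym i≢k) (≢-sym j≢k) ⟩
    k                       ≡⟨ transpose-left x k ⟨
    τ x k x                 ∎
  ... | at-right _ refl = begin
    τ i x (τ x k (τ i x x)) ≡⟨ cong (λ y → τ i x (τ x k y)) (transpose-right i x) ⟩
    τ i x (τ x k i)         ≡⟨ cong (τ i x) (transpose-other x k i≢j i≢k) ⟩
    τ i x i                 ≡⟨ transpose-left i x ⟩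
    x                       ≡⟨ transpose-other i k (≢-sym i≢j) j≢k ⟨
    τ i k x                 ∎
  ... | elsewhere x≢i x≢j with position _≟_ i k x
  ...   | at-left x≡i = ⊥-elim (x≢i x≡i)
  ...   | at-right _ refl = begin
    τ i j (τ j x (τ i j x)) ≡⟨ cong (λ y → τ i j (τ j x y)) (transpose-other i j x≢i x≢j) ⟩
    τ i j (τ j x x)         ≡⟨ cong (τ i j) (transpose-right j x) ⟩
    τ i j j                 ≡⟨ transpose-right i j ⟩
    i                       ≡⟨ transpose-right i x ⟨
    τ i x x                 ∎
  ...   | elsewhere _ x≢k = begin
    τ i j (τ j k (τ i j x)) ≡⟨ cong (λ y → τ i j (τ j k y)) (transpose-other i j x≢i x≢j) ⟩
    τ i j (τ j k x)         ≡⟨ cong (τ i j) (transpose-other j k x≢j x≢k) ⟩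
    τ i j x                 ≡⟨ transpose-other i j x≢i x≢j ⟩
    x                       ≡⟨ transpose-other i k x≢i x≢k ⟨
    τ i k x                 ∎

  transpose-comm : ∀ {i j k l : Fin n} → i ≢ k → i ≢ l → j ≢ k → j ≢ l →
                   ∀ x → τ i j (τ k l x) ≡ τ k l (τ i j x)
  transpose-comm {i} {j} {k} {l} i≢k i≢l j≢k j≢l x with position _≟_ i j x | position _≟_ k l x
  ... | at-left refl | _ = begin
    τ x j (τ k l x) ≡⟨ cong (τ x j) (transpose-other k l i≢k i≢l) ⟩
    τ x j x         ≡⟨ transpose-left x j ⟩
    j               ≡⟨ transpose-other k l j≢k j≢l ⟨
    τ k l j         ≡⟨ cong (τ k l) (transpose-left x j) ⟨
    τ k l (τ x j x) ∎
  ... | at-right _ refl | _ = begin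
    τ i x (τ k l x) ≡⟨ cong (τ i x) (transpose-other k l j≢k j≢l) ⟩
    τ i x x         ≡⟨ transpose-right i x ⟩
    i               ≡⟨ transpose-other k l i≢k i≢l ⟨
    τ k l i         ≡⟨ cong (τ k l) (transpose-right i x) ⟨
    τ k l (τ i x x) ∎
  ... | elsewhere x≢i x≢j | at-left refl = begin
    τ i j (τ x l x) ≡⟨ cong (τ i j) (transpose-left x l) ⟩
    τ i j l         ≡⟨ transpose-other i j (≢-sym i≢l) (≢-sym j≢l) ⟩
    l               ≡⟨ transpose-left x l ⟨
    τ x l x         ≡⟨ cong (τ x l) (transpose-other i j x≢i x≢j) ⟨
    τ x l (τ i j x) ∎
  ... | elsewhere x≢i x≢j | at-right _ refl = begin
    τ i j (τ k x x) ≡⟨ cong (τ i j) (transpose-right k x) ⟩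
    τ i j k         ≡⟨ transpose-other i j (≢-sym i≢k) (≢-sym j≢k) ⟩
    k               ≡⟨ transpose-right k x ⟨
    τ k x x         ≡⟨ cong (τ k x) (transpose-other i j x≢i x≢j) ⟨
    τ k x (τ i j x) ∎
  ... | elsewhere x≢i x≢j | elsewhere x≢k x≢l = begin
    τ i j (τ k l x) ≡⟨ cong (τ i j) (transpose-other k l x≢k x≢l) ⟩
    τ i j x         ≡⟨ transpose-other i j x≢i x≢j ⟩
    x               ≡⟨ transpose-other k l x≢k x≢l ⟨
    τ k l x         ≡⟨ cong (τ k l) (transpose-other i j x≢i x≢j) ⟨
    τ k l (τ i j x) ∎

⟨$⟩ʳ-injective : ∀ {n} (σ : Perm n) {x y} → σ ⟨$⟩ʳ x ≡ σ ⟨$⟩ʳ y → x ≡ y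
⟨$⟩ʳ-injective σ {x} {y} eq = trans (sym (inverseˡ σ)) (trans (cong (σ ⟨$⟩ˡ_) eq) (inverseˡ σ))

flip-≈ : ∀ {n} {π σ : Perm n} → π ≈ₚ σ → flip π ≈ₚ flip σ
flip-≈ {π = π} {σ} π≈σ z = begin
  π ⟨$⟩ˡ z                    ≡⟨ inverseˡ σ ⟨
  σ ⟨$⟩ˡ (σ ⟨$⟩ʳ (π ⟨$⟩ˡ z))   ≡⟨ cong (σ ⟨$⟩ˡ_) (π≈σ (π ⟨$⟩ˡ z)) ⟨
  σ ⟨$⟩ˡ (π ⟨$⟩ʳ (π ⟨$⟩ˡ z))   ≡⟨ cong (σ ⟨$⟩ˡ_) (inverseʳ π) ⟩
  σ ⟨$⟩ˡ z                    ∎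
  where open ≡-Reasoning

adjacent : ∀ {m} → Fin m → Perm (suc m)
adjacent i = transpose (inject₁ i) (fsuc i)

adjacent-lift₀ : ∀ {m} (i : Fin m) → adjacent (fsuc i) ≈ₚ lift₀ (adjacent i)
adjacent-lift₀ i = lift₀-transpose (inject₁ i) (fsuc i)

adjacent-other : ∀ {m} {i : Fin m} {p} → toℕ p ≢ toℕ i → toℕ p ≢ suc (toℕ i) → adjacent i ⟨$⟩ʳ p ≡ p
adjacent-other {i = i} p≢i p≢1+i =
  transpose-other (inject₁ i) (fsuc i) (λ eq → p≢i (trans (cong toℕ eq) (toℕ-inject₁ i))) (p≢1+i ∘′ cong toℕ)

NonAdjacent : ℕ → ℕ → Set
NonAdjacent a b = a ≢ b × a ≢ suc b × suc a ≢ b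

nonAdjacent : ∀ a b → 2 ≤ (a ∸ b) + (b ∸ a) → NonAdjacent a b
nonAdjacent a b 2≤dist = (λ { refl → ℕ.<⇒≱ (s≤s z≤n) (subst (2 ≤_) (dist-self a) 2≤dist) })
                        , (λ { refl → ℕ.<⇒≱ ℕ.≤-refl (subst (2 ≤_) (dist-suc b) 2≤dist) })
                        , (λ { refl → ℕ.<⇒≱ ℕ.≤-refl
                                        (subst (2 ≤_) (trans (ℕ.+-comm (a ∸ suc a) (suc a ∸ a)) (dist-suc a)) 2≤dist) })
  where
  dist-self : ∀ n → (n ∸ n) + (n ∸ n) ≡ 0
  dist-self n rewrite ℕ.n∸n≡0 n = refl
  dist-suc : ∀ n → (suc n ∸ n) + (n ∸ suc n) ≡ 1
  dist-suc n rewrite ℕ.m+n∸n≡m 1 n | ℕ.m≤n⇒m∸n≡0 (ℕ.n≤1+n n) = refl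

adjacent-comm : ∀ {m} {i j : Fin m} → NonAdjacent (toℕ i) (toℕ j) →
                ∀ p → adjacent i ⟨$⟩ʳ (adjacent j ⟨$⟩ʳ p) ≡ adjacent j ⟨$⟩ʳ (adjacent i ⟨$⟩ʳ p)
adjacent-comm {i = i} {j} (i≢j , i≢1+j , 1+i≢j) = transpose-comm
  (λ eq → i≢j (trans (sym (toℕ-inject₁ i)) (trans (cong toℕ eq) (toℕ-inject₁ j))))
  (λ eq → i≢1+j (trans (sym (toℕ-inject₁ i)) (cong toℕ eq)))
  (λ eq → 1+i≢j (trans (cong toℕ eq) (toℕ-inject₁ j)))
  (λ eq → i≢j (ℕ.suc-injective (cong toℕ eq)))

adjacent-moves : ∀ {m} (i : Fin m) → adjacent i ⟨$⟩ʳ inject₁ i ≢ inject₁ i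
adjacent-moves i eq = ℕ.<⇒≢ (ℕ.n<1+n (toℕ i))
  (sym (trans (cong toℕ (trans (sym (transpose-left (inject₁ i) (fsuc i))) eq)) (toℕ-inject₁ i)))

PreservesPrefix : ∀ {m} → Perm (suc m) → Fin m → Set
PreservesPrefix σ i = ∀ p → toℕ p ≤ toℕ i ⇔ toℕ (σ ⟨$⟩ʳ p) ≤ toℕ i

module _ {m : ℕ} where

  private
    _≤ᶠ_ : ∀ {k} → Fin k → Fin m → Set
    p ≤ᶠ i = toℕ p ≤ toℕ i

  PreservesPrefix-id : ∀ i → PreservesPrefix {m} idₚ i
  PreservesPrefix-id i p = mk⇔ (λ p≤i → p≤i) (λ p≤i → p≤i)

  PreservesPrefix-∘ : ∀ {π σ i} → PreservesPrefix {m} π i → PreservesPrefix σ i → PreservesPrefix (π ∘ₚ σ) i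
  PreservesPrefix-∘ {π} π-pres σ-pres p =
    mk⇔ (to (σ-pres (π ⟨$⟩ʳ p)) ∘′ to (π-pres p)) (from (π-pres p) ∘′ from (σ-pres (π ⟨$⟩ʳ p)))

  PreservesPrefix-flip : ∀ {π i} → PreservesPrefix {m} π i → PreservesPrefix (flip π) i
  PreservesPrefix-flip {π} {i} π-pres p =
    mk⇔ (λ p≤i → from (π-pres (π ⟨$⟩ˡ p)) (subst (_≤ᶠ i) (sym (inverseʳ π)) p≤i))
        (λ q≤i → subst (_≤ᶠ i) (inverseʳ π) (to (π-pres (π ⟨$⟩ˡ p)) q≤i))

  PreservesPrefix-≈ : ∀ {π σ i} → π ≈ₚ σ → PreservesPrefix {m} π i → PreservesPrefix σ i
  PreservesPrefix-≈ {i = i} π≈σ π-pres p =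
    mk⇔ (subst (_≤ᶠ i) (π≈σ p) ∘′ to (π-pres p)) (from (π-pres p) ∘′ subst (_≤ᶠ i) (sym (π≈σ p)))

  adjacent-preservesPrefix : ∀ {j i : Fin m} → toℕ j ≢ toℕ i → PreservesPrefix (adjacent j) i
  adjacent-preservesPrefix {j} {i} j≢i p with position _≟_ (inject₁ j) (fsuc j) p
  ... | at-left refl rewrite transpose-left (inject₁ j) (fsuc j) | toℕ-inject₁ j =
    mk⇔ (λ j≤i → ℕ.≤∧≢⇒< j≤i j≢i) ℕ.<⇒≤
  ... | at-right _ refl rewrite transpose-right (inject₁ j) (fsuc j) | toℕ-inject₁ j =
    mk⇔ ℕ.<⇒≤ (λ j≤i → ℕ.≤∧≢⇒< j≤i j≢i)
  ... | elsewhere p≢j p≢j+1 rewrite transpose-other (inject₁ j) (fsuc j) p≢j p≢j+1 =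
    mk⇔ (λ p≤i → p≤i) (λ p≤i → p≤i)

PreservesPrefix-lift₀ : ∀ {m} {π : Perm (suc m)} {i} → PreservesPrefix π i → PreservesPrefix (lift₀ π) (fsuc i)
PreservesPrefix-lift₀ π-pres fzero = mk⇔ (λ _ → z≤n) (λ _ → z≤n)
PreservesPrefix-lift₀ π-pres (fsuc p) =
  mk⇔ (s≤s ∘′ to (π-pres p) ∘′ ℕ.≤-pred) (s≤s ∘′ from (π-pres p) ∘′ ℕ.≤-pred)

PreservesPrefix-lift₀⁻ : ∀ {m} {π : Perm (suc m)} {i} → PreservesPrefix (lift₀ π) (fsuc i) → PreservesPrefix π i
PreservesPrefix-lift₀⁻ π-pres p =
  mk⇔ (ℕ.≤-pred ∘′ to (π-pres (fsuc p)) ∘′ s≤s) (ℕ.≤-pred ∘′ from (π-pres (fsuc p)) ∘′ s≤s)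

fixesPrefix⇒preservesPrefix : ∀ {m} {σ : Perm (suc m)} {i j : Fin m} → toℕ i ≤ toℕ j →
                              (∀ p → toℕ p ≤ toℕ j → σ ⟨$⟩ʳ p ≡ p) → PreservesPrefix σ i
fixesPrefix⇒preservesPrefix {σ = σ} {i} i≤j fixes p =
  mk⇔ (λ p≤i → subst (λ q → toℕ q ≤ toℕ i) (sym (fixes p (ℕ.≤-trans p≤i i≤j))) p≤i)
      (λ σp≤i → subst (λ q → toℕ q ≤ toℕ i)
                      (⟨$⟩ʳ-injective σ (fixes (σ ⟨$⟩ʳ p) (ℕ.≤-trans σp≤i i≤j))) σp≤i)

fixesLast⇒preservesPrefix : ∀ {m} {σ : Perm (suc (suc m))} →
                            σ ⟨$⟩ʳ fromℕ (suc m) ≡ fromℕ (suc m) → PreservesPrefix σ (fromℕ m)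
fixesLast⇒preservesPrefix {m} {σ} fixes p =
  mk⇔ (λ p≤m → ≢last⇒≤ (σ ⟨$⟩ʳ p)
                 (λ σp≡last → ≤⇒≢last p p≤m (⟨$⟩ʳ-injective σ (trans σp≡last (sym fixes)))))
      (λ σp≤m → ≢last⇒≤ p (λ p≡last → ≤⇒≢last (σ ⟨$⟩ʳ p) σp≤m (trans (cong (σ ⟨$⟩ʳ_) p≡last) fixes)))
  where
  ≤⇒≢last : ∀ q → toℕ q ≤ toℕ (fromℕ m) → q ≢ fromℕ (suc m)
  ≤⇒≢last q q≤m refl = ℕ.<⇒≱ (subst₂ _<_ (sym (toℕ-fromℕ m)) (sym (toℕ-fromℕ (suc m))) (ℕ.n<1+n m)) q≤m
  ≢last⇒≤ : ∀ q → q ≢ fromℕ (suc m) → toℕ q ≤ toℕ (fromℕ m)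
  ≢last⇒≤ q q≢last = subst (toℕ q ≤_) (sym (toℕ-fromℕ m))
    (ℕ.≤-pred (ℕ.≤∧≢⇒< (ℕ.≤-pred (toℕ<n q)) (λ eq → q≢last (toℕ-injective (trans eq (sym (toℕ-fromℕ (suc m))))))))

flip-agree : ∀ {m} (a b : Perm (suc m)) {i} → PreservesPrefix a i → (∀ p → toℕ p ≤ toℕ i → a ⟨$⟩ʳ p ≡ b ⟨$⟩ʳ p) →
             ∀ p → toℕ p ≤ toℕ i → a ⟨$⟩ˡ p ≡ b ⟨$⟩ˡ p
flip-agree a b {i} a-pres a≡b p p≤i = begin
  a ⟨$⟩ˡ p                    ≡⟨ inverseˡ b ⟨
  b ⟨$⟩ˡ (b ⟨$⟩ʳ (a ⟨$⟩ˡ p))   ≡⟨ cong (b ⟨$⟩ˡ_) (a≡b (a ⟨$⟩ˡ p) a⁻¹p≤i) ⟨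
  b ⟨$⟩ˡ (a ⟨$⟩ʳ (a ⟨$⟩ˡ p))   ≡⟨ cong (b ⟨$⟩ˡ_) (inverseʳ a) ⟩
  b ⟨$⟩ˡ p                    ∎
  where
  open ≡-Reasoning
  a⁻¹p≤i : toℕ (a ⟨$⟩ˡ p) ≤ toℕ i
  a⁻¹p≤i = from (a-pres (a ⟨$⟩ˡ p)) (subst (λ q → toℕ q ≤ toℕ i) (sym (inverseʳ a)) p≤i)

-- Young subgroups

record IsSubgroup {n : ℕ} (H : Perm n → Set) : Set where
  field
    id-closed   : H idₚ
    ∘-closed    : ∀ {π σ} → H π → H σ → H (π ∘ₚ σ)
    flip-closed : ∀ {π} → H π → H (flip π)
    ≈-closed    : ∀ {π σ} → π ≈ₚ σ → H π → H σ

open IsSubgroup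

IsSubgroup-lift₀ : ∀ {n} {H : Perm (suc n) → Set} → IsSubgroup H → IsSubgroup (λ π → H (lift₀ π))
IsSubgroup-lift₀ {H = H} sub = record
  { id-closed   = ≈-closed sub (λ i → sym (lift₀-id i)) (id-closed sub)
  ; ∘-closed    = λ {π} {σ} hπ hσ → ≈-closed sub (lift₀-comp π σ) (∘-closed sub hπ hσ)
  ; flip-closed = λ {π} hπ → ≈-closed sub (flip-lift₀ π) (flip-closed sub hπ)
  ; ≈-closed    = λ {π} {σ} π≈σ → ≈-closed sub (lift₀-cong π σ π≈σ)
  }
  where
  flip-lift₀ : ∀ {n} (π : Perm n) → flip (lift₀ π) ≈ₚ lift₀ (flip π)
  flip-lift₀ π fzero = refl
  flip-lift₀ π (fsuc i) = refl

toZero : ∀ {n} → Fin n → Perm n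
toZero {suc n} fzero = idₚ
toZero {suc (suc n)} (fsuc q) = lift₀ (toZero q) ∘ₚ adjacent fzero

toZero-sends : ∀ {n} (q : Fin (suc n)) → toZero q ⟨$⟩ʳ q ≡ fzero
toZero-sends fzero = refl
toZero-sends {suc n} (fsuc q) rewrite toZero-sends q = transpose-right fzero (fsuc fzero)

toZero-preservesPrefix : ∀ {m} (q : Fin (suc m)) (i : Fin m) → toℕ q ≤ toℕ i → PreservesPrefix (toZero q) i
toZero-preservesPrefix fzero i _ = PreservesPrefix-id i
toZero-preservesPrefix {suc m} (fsuc q) (fsuc i) (s≤s q≤i) =
  PreservesPrefix-∘ {π = lift₀ (toZero q)} {σ = adjacent fzero}
    (PreservesPrefix-lift₀ (toZero-preservesPrefix q i q≤i)) (adjacent-preservesPrefix λ ())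

toZero-∈ : ∀ {m} {H : Perm (suc m) → Set} → IsSubgroup H → (q : Fin (suc m)) →
           (∀ i → toℕ i < toℕ q → H (adjacent i)) → H (toZero q)
toZero-∈ sub fzero _ = id-closed sub
toZero-∈ {suc m} sub (fsuc q) adjacent∈ =
  ∘-closed sub
    (toZero-∈ (IsSubgroup-lift₀ sub) q λ i i<q → ≈-closed sub (adjacent-lift₀ i) (adjacent∈ (fsuc i) (s≤s i<q)))
    (adjacent∈ fzero (s≤s z≤n))

-- Adjacent transpositions below σ(0) all lie in H (σ preserves no prefix ending below σ(0)),
-- so σ(0) can be moved back to 0 inside H; the remaining permutation fixes 0 and is handled
-- one size down.
young-generation : ∀ {m} {H : Perm (suc m) → Set} → IsSubgroup H →
  {A : Fin m → Set} → Decidable A → (∀ i → A i → H (adjacent i)) →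
  ∀ σ → (∀ i → ¬ A i → PreservesPrefix σ i) → H σ
young-generation {zero} sub _ _ σ _ = ≈-closed sub (λ { fzero → sym (Fin1 (σ ⟨$⟩ʳ fzero)) }) (id-closed sub)
  where
  Fin1 : ∀ (p : Fin 1) → p ≡ fzero
  Fin1 fzero = refl
young-generation {suc m} {H} sub {A} A? adjacent∈ σ σ-pres =
  ≈-closed sub (λ _ → inverseˡ (toZero q)) (∘-closed sub σ′∈ (flip-closed sub (toZero-∈ sub q below-q∈)))
  where
  q : Fin (suc (suc m))
  q = σ ⟨$⟩ʳ fzero
  below-q : ∀ i → toℕ i < toℕ q → A i
  below-q i i<q with A? i
  ... | yes a = a
  ... | no ¬a = ⊥-elim (ℕ.<⇒≱ i<q (to (σ-pres i ¬a fzero) z≤n))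
  below-q∈ : ∀ i → toℕ i < toℕ q → H (adjacent i)
  below-q∈ i i<q = adjacent∈ i (below-q i i<q)
  σ′ : Perm (suc (suc m))
  σ′ = σ ∘ₚ toZero q
  lift₀-remove-σ′ : lift₀ (remove fzero σ′) ≈ₚ σ′
  lift₀-remove-σ′ = lift₀-remove σ′ (toZero-sends q)
  σ′-pres : ∀ i → ¬ A (fsuc i) → PreservesPrefix (remove fzero σ′) i
  σ′-pres i ¬a = PreservesPrefix-lift₀⁻
    (PreservesPrefix-≈ {π = σ′} {σ = lift₀ (remove fzero σ′)} (λ p → sym (lift₀-remove-σ′ p))
      (PreservesPrefix-∘ {π = σ} {σ = toZero q} (σ-pres (fsuc i) ¬a)
        (toZero-preservesPrefix q (fsuc i) (ℕ.≮⇒≥ (¬a ∘′ below-q (fsuc i))))))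
  σ′∈ : H σ′
  σ′∈ = ≈-closed sub lift₀-remove-σ′
    (young-generation (IsSubgroup-lift₀ sub) {A ∘′ fsuc} (λ i → A? (fsuc i))
      (λ i a → ≈-closed sub (adjacent-lift₀ i) (adjacent∈ (fsuc i) a)) (remove fzero σ′) σ′-pres)

swapℕ : ℕ → ℕ → ℕ → ℕ
swapℕ a b x = if does (x ℕ.≟ a) then b else if does (x ℕ.≟ b) then a else x

module _ (a b : ℕ) where

  swapℕ-left : swapℕ a b a ≡ b
  swapℕ-left rewrite dec-true (a ℕ.≟ a) refl = refl

  swapℕ-right : swapℕ a b b ≡ a
  swapℕ-right with b ℕ.≟ a
  ... | yes refl = swapℕ-left
  ... | no b≢a rewrite dec-false (b ℕ.≟ a) b≢a | dec-true (b ℕ.≟ b) refl = refl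

  swapℕ-other : ∀ {x} → x ≢ a → x ≢ b → swapℕ a b x ≡ x
  swapℕ-other {x} x≢a x≢b rewrite dec-false (x ℕ.≟ a) x≢a | dec-false (x ℕ.≟ b) x≢b = refl

swapℕ-+ : ∀ c a b x → swapℕ (c + a) (c + b) (c + x) ≡ c + swapℕ a b x
swapℕ-+ c a b x with position ℕ._≟_ a b x
... | at-left refl = trans (swapℕ-left (c + x) (c + b)) (cong (c +_) (sym (swapℕ-left x b)))
... | at-right _ refl = trans (swapℕ-right (c + a) (c + x)) (cong (c +_) (sym (swapℕ-right a x)))
... | elsewhere x≢a x≢b =
  trans (swapℕ-other (c + a) (c + b) (x≢a ∘ ℕ.+-cancelˡ-≡ c _ _) (x≢b ∘ ℕ.+-cancelˡ-≡ c _ _))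
        (cong (c +_) (sym (swapℕ-other a b x≢a x≢b)))

toℕ-transpose : ∀ {n} (a b x : Fin n) → toℕ (transpose a b ⟨$⟩ʳ x) ≡ swapℕ (toℕ a) (toℕ b) (toℕ x)
toℕ-transpose a b x with position _≟_ a b x
... | at-left refl = trans (cong toℕ (transpose-left x b)) (sym (swapℕ-left (toℕ x) (toℕ b)))
... | at-right _ refl = trans (cong toℕ (transpose-right a x)) (sym (swapℕ-right (toℕ a) (toℕ x)))
... | elsewhere x≢a x≢b =
  trans (cong toℕ (transpose-other a b x≢a x≢b))
        (sym (swapℕ-other (toℕ a) (toℕ b) (x≢a ∘ toℕ-injective) (x≢b ∘ toℕ-injective)))

swapℕ-beyond : ∀ {a b x} → a < x → b < x → swapℕ a b x ≡ x
swapℕ-beyond a<x b<x = swapℕ-other _ _ (ℕ.>⇒≢ a<x) (ℕ.>⇒≢ b<x)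

swapℕ-below : ∀ {a b x} → x < a → x < b → swapℕ a b x ≡ x
swapℕ-below x<a x<b = swapℕ-other _ _ (ℕ.<⇒≢ x<a) (ℕ.<⇒≢ x<b)

swapℕ-< : ∀ {n a b x} → a < n → b < n → x < n → swapℕ a b x < n
swapℕ-< {a = a} {b} {x} a<n b<n x<n with position ℕ._≟_ a b x
... | at-left refl = subst (_< _) (sym (swapℕ-left x b)) b<n
... | at-right _ refl = subst (_< _) (sym (swapℕ-right a x)) a<n
... | elsewhere x≢a x≢b = subst (_< _) (sym (swapℕ-other a b x≢a x≢b)) x<n

swapℕ-fixed⁻¹ : ∀ {a b x y} → swapℕ a b x ≡ y → y ≢ a → y ≢ b → x ≡ y
swapℕ-fixed⁻¹ {a} {b} {x} eq y≢a y≢b with position ℕ._≟_ a b x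
... | at-left refl = ⊥-elim (y≢b (trans (sym eq) (swapℕ-left x b)))
... | at-right _ refl = ⊥-elim (y≢a (trans (sym eq) (swapℕ-right a x)))
... | elsewhere x≢a x≢b = trans (sym (swapℕ-other a b x≢a x≢b)) eq

toℕ-adjacent : ∀ {m} (i : Fin m) p → toℕ (adjacent i ⟨$⟩ʳ p) ≡ swapℕ (toℕ i) (suc (toℕ i)) (toℕ p)
toℕ-adjacent i p = trans (toℕ-transpose (inject₁ i) (fsuc i) p) (cong (λ a → swapℕ a (suc (toℕ i)) (toℕ p)) (toℕ-inject₁ i))

Edgeℕ : Set
Edgeℕ = ℕ × ℕ × ℕ

swapAt : ℕ → ℕ → Edgeℕ → ℕ
swapAt L x (l , a , b) with l ℕ.≟ L
... | yes _ = swapℕ a b x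
... | no _ = x

swapAlong : List Edgeℕ → ℕ → ℕ → ℕ
swapAlong es L x = foldl (swapAt L) x es

InRange : ℕ → ℕ → Edgeℕ → Set
InRange n r (l , a , b) = l < r × a < n × b < n

toFin?-< : ∀ {m} k (k<m : k < m) → toFin? {m} k ≡ just (fromℕ< k<m)
toFin?-< {m} k k<m with k ℕ.<? m
... | yes _ = refl
... | no k≮m = ⊥-elim (k≮m k<m)

toℕ-edgeInvolution-mkEdges : ∀ {n r} es → All (InRange n r) es → ∀ l z →
  toℕ (edgeInvolution {n} {r} (mkEdges es) l ⟨$⟩ʳ z) ≡ swapAlong es (toℕ l) (toℕ z)
toℕ-edgeInvolution-mkEdges [] [] l z = refl
toℕ-edgeInvolution-mkEdges {n} {r} ((l′ , a , b) ∷ es) ((l′<r , a<n , b<n) ∷ in-range) l z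
  rewrite toFin?-< {r} l′ l′<r | toFin?-< {n} a a<n | toFin?-< {n} b b<n
  with toℕ (fromℕ< l′<r) ℕ.≟ toℕ l | l′ ℕ.≟ toℕ l
... | yes _ | yes _ =
  trans (toℕ-edgeInvolution-mkEdges es in-range l _)
        (cong (swapAlong es (toℕ l))
              (trans (toℕ-transpose _ _ z) (cong₂ (λ a b → swapℕ a b (toℕ z)) (toℕ-fromℕ< a<n) (toℕ-fromℕ< b<n))))
... | yes eq | no neq = ⊥-elim (neq (trans (sym (toℕ-fromℕ< l′<r)) eq))
... | no neq | yes eq = ⊥-elim (neq (trans (toℕ-fromℕ< l′<r) eq))
... | no _ | no _ = toℕ-edgeInvolution-mkEdges es in-range l z

swapAt-same : ∀ l a b x → swapAt l x (l , a , b) ≡ swapℕ a b x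
swapAt-same l a b x with l ℕ.≟ l
... | yes _ = refl
... | no l≢l = ⊥-elim (l≢l refl)

swapAt-other : ∀ {l L} a b x → l ≢ L → swapAt L x (l , a , b) ≡ x
swapAt-other {l} {L} a b x l≢L with l ℕ.≟ L
... | yes l≡L = ⊥-elim (l≢L l≡L)
... | no _ = refl

swapAlong-upTo-suc : ∀ (h : ℕ → Edgeℕ) n L x →
  swapAlong (map h (upTo (suc n))) L x ≡ swapAt L (swapAlong (map h (upTo n)) L x) (h n)
swapAlong-upTo-suc h n L x = begin
  swapAlong (map h (upTo (suc n))) L x       ≡⟨ cong (λ is → swapAlong (map h is) L x) (upTo-∷ʳ n) ⟨
  swapAlong (map h (upTo n ++ [ n ])) L x    ≡⟨ cong (λ es → swapAlong es L x) (map-++ h (upTo n) [ n ]) ⟩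
  swapAlong (map h (upTo n) ++ [ h n ]) L x  ≡⟨ foldl-++ (swapAt L) x (map h (upTo n)) [ h n ] ⟩
  swapAt L (swapAlong (map h (upTo n)) L x) (h n) ∎
  where open ≡-Reasoning

swapAlong-unlabelled : ∀ {R L} → R ≢ L → ∀ (h : ℕ → ℕ × ℕ) is x →
  swapAlong (map (λ i → (R , h i)) is) L x ≡ x
swapAlong-unlabelled R≢L h [] x = refl
swapAlong-unlabelled R≢L h (i ∷ is) x
  rewrite swapAt-other (proj₁ (h i)) (proj₂ (h i)) x R≢L = swapAlong-unlabelled R≢L h is x

path : (ℕ → ℕ) → ℕ → List Edgeℕ
path f n = map (λ i → (i , f i , f (suc i))) (upTo n)

swapAlong-path-≥ : ∀ f {n L} x → n ≤ L → swapAlong (path f n) L x ≡ x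
swapAlong-path-≥ f {zero} x _ = refl
swapAlong-path-≥ f {suc n} {L} x n<L
  rewrite swapAlong-upTo-suc (λ i → (i , f i , f (suc i))) n L x
        | swapAlong-path-≥ f x (ℕ.<⇒≤ n<L) = swapAt-other _ _ x (ℕ.<⇒≢ n<L)

swapAlong-path-< : ∀ f {n L} x → L < n → swapAlong (path f n) L x ≡ swapℕ (f L) (f (suc L)) x
swapAlong-path-< f {suc n} {L} x L<1+n
  rewrite swapAlong-upTo-suc (λ i → (i , f i , f (suc i))) n L x with ℕ.m<1+n⇒m<n∨m≡n L<1+n
... | inj₁ L<n rewrite swapAlong-path-< f x L<n = swapAt-other _ _ _ (ℕ.>⇒≢ L<n)
... | inj₂ refl rewrite swapAlong-path-≥ f x (ℕ.≤-refl {n}) = swapAt-same n _ _ x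

rungs : ℕ → ℕ → ℕ → List Edgeℕ
rungs R c n = map (λ i → (R , i , c + suc i)) (upTo n)

module _ (R c : ℕ) where

  private
    along : ℕ → ℕ → ℕ
    along n = swapAlong (rungs R c n) R

    along-suc : ∀ n x → along (suc n) x ≡ swapℕ n (c + suc n) (along n x)
    along-suc n x = trans (swapAlong-upTo-suc (λ i → (R , i , c + suc i)) n R x) (swapAt-same R n _ _)

    c+1+y≢ : ∀ {y n} → n ≤ c → c + suc y ≢ n
    c+1+y≢ n≤c eq = ℕ.<⇒≢ (ℕ.≤-<-trans n≤c (ℕ.m<m+n _ (s≤s z≤n))) (sym eq)

  swapAlong-rungs-middle : ∀ {n x} → n ≤ x → x ≤ c → swapAlong (rungs R c n) R x ≡ x
  swapAlong-rungs-middle {zero} _ _ = refl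
  swapAlong-rungs-middle {suc n} {x} n<x x≤c rewrite along-suc n x | swapAlong-rungs-middle (ℕ.<⇒≤ n<x) x≤c =
    swapℕ-other _ _ (ℕ.>⇒≢ n<x) (ℕ.<⇒≢ (ℕ.≤-<-trans x≤c (ℕ.m<m+n c (s≤s z≤n))))

  swapAlong-rungs-beyond : ∀ {n y} → n ≤ y → swapAlong (rungs R c n) R (c + suc y) ≡ c + suc y
  swapAlong-rungs-beyond {zero} _ = refl
  swapAlong-rungs-beyond {suc n} {y} n<y rewrite along-suc n (c + suc y) | swapAlong-rungs-beyond (ℕ.<⇒≤ n<y) =
    swapℕ-other _ _
      (λ eq → ℕ.<⇒≢ (ℕ.<-≤-trans n<y (ℕ.≤-trans (ℕ.n≤1+n y) (ℕ.m≤n+m (suc y) c))) (sym eq))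
      (λ eq → ℕ.>⇒≢ n<y (ℕ.suc-injective (ℕ.+-cancelˡ-≡ c _ _ eq)))

  swapAlong-rungs-foot : ∀ {n y} → n ≤ c → y < n → swapAlong (rungs R c n) R y ≡ c + suc y
  swapAlong-rungs-foot {suc n} {y} n<c y<1+n rewrite along-suc n y with ℕ.m<1+n⇒m<n∨m≡n y<1+n
  ... | inj₁ y<n rewrite swapAlong-rungs-foot (ℕ.<⇒≤ n<c) y<n =
    swapℕ-other _ _ (c+1+y≢ (ℕ.<⇒≤ n<c)) (ℕ.<⇒≢ y<n ∘ ℕ.suc-injective ∘ ℕ.+-cancelˡ-≡ c _ _)
  ... | inj₂ refl rewrite swapAlong-rungs-middle (ℕ.≤-refl {n}) (ℕ.<⇒≤ n<c) = swapℕ-left n (c + suc n)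

  swapAlong-rungs-head : ∀ {n y} → n ≤ c → y < n → swapAlong (rungs R c n) R (c + suc y) ≡ y
  swapAlong-rungs-head {suc n} {y} n<c y<1+n rewrite along-suc n (c + suc y) with ℕ.m<1+n⇒m<n∨m≡n y<1+n
  ... | inj₁ y<n rewrite swapAlong-rungs-head (ℕ.<⇒≤ n<c) y<n =
    swapℕ-other _ _ (ℕ.<⇒≢ y<n) (ℕ.<⇒≢ (ℕ.<-≤-trans y<n (ℕ.≤-trans (ℕ.<⇒≤ n<c) (ℕ.m≤m+n c (suc n)))))
  ... | inj₂ refl rewrite swapAlong-rungs-beyond (ℕ.≤-refl {n}) = swapℕ-right n (c + suc n)

-- The wreath product acting on two copies of Fin r

module _ {r : ℕ} where

  εW : Wr r
  εW = idₚ , idₚ , false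

  _⁻¹W : Wr r → Wr r
  (a , b , false) ⁻¹W = flip a , flip b , false
  (a , b , true) ⁻¹W = flip b , flip a , true

  ·W-inverseʳ : ∀ x → x ·W x ⁻¹W ≈W εW
  ·W-inverseʳ (a , b , false) = (λ _ → inverseˡ a) , (λ _ → inverseˡ b) , refl
  ·W-inverseʳ (a , b , true) = (λ _ → inverseˡ a) , (λ _ → inverseˡ b) , refl

  coordinate : Bool → Perm r → Perm r → Perm r
  coordinate false a b = a
  coordinate true a b = b

  act : Fin r × Bool → Wr r → Fin r × Bool
  act (p , c) (a , b , s) = coordinate c a b ⟨$⟩ʳ p , c xor s

  act⁻¹ : Fin r × Bool → Wr r → Fin r × Bool
  act⁻¹ (q , c) (a , b , s) = coordinate (c xor s) a b ⟨$⟩ˡ q , c xor s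

  act⁻¹-act : ∀ w x → act⁻¹ (act w x) x ≡ w
  act⁻¹-act (p , false) (a , b , false) = cong (_, false) (inverseˡ a)
  act⁻¹-act (p , false) (a , b , true) = cong (_, false) (inverseˡ a)
  act⁻¹-act (p , true) (a , b , false) = cong (_, true) (inverseˡ b)
  act⁻¹-act (p , true) (a , b , true) = cong (_, true) (inverseˡ b)

  act-act⁻¹ : ∀ w x → act (act⁻¹ w x) x ≡ w
  act-act⁻¹ (p , false) (a , b , false) = cong (_, false) (inverseʳ a)
  act-act⁻¹ (p , false) (a , b , true) = cong (_, false) (inverseʳ b)
  act-act⁻¹ (p , true) (a , b , false) = cong (_, true) (inverseʳ b)
  act-act⁻¹ (p , true) (a , b , true) = cong (_, true) (inverseʳ a)

  act-·W : ∀ w x y → act w (x ·W y) ≡ act (act w x) y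
  act-·W (p , false) (a , b , false) (c , d , t) = refl
  act-·W (p , false) (a , b , true) (c , d , t) = refl
  act-·W (p , true) (a , b , false) (c , d , t) = refl
  act-·W (p , true) (a , b , true) (c , d , false) = refl
  act-·W (p , true) (a , b , true) (c , d , true) = refl

  act-cong : ∀ w {x y} → x ≈W y → act w x ≡ act w y
  act-cong (p , false) (a≈c , _ , refl) = cong (_, _) (a≈c p)
  act-cong (p , true) (_ , b≈d , refl) = cong (_, _) (b≈d p)

  act-ε : ∀ w → act w εW ≡ w
  act-ε (p , false) = refl
  act-ε (p , true) = refl

module Representation {m n : ℕ} (E : Fin (suc m) × Bool → Fin n) (D : Fin n → Fin (suc m) × Bool)
                      (E∘D : ∀ z → E (D z) ≡ z) (D∘E : ∀ w → D (E w) ≡ w) where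

  φ : Wr (suc m) → Perm n
  φ x = permutation (λ z → E (act (D z) x)) (λ z → E (act⁻¹ (D z) x))
    (λ z → trans (cong (λ w → E (act w x)) (D∘E _)) (trans (cong E (act-act⁻¹ (D z) x)) (E∘D z)))
    (λ z → trans (cong (λ w → E (act⁻¹ w x)) (D∘E _)) (trans (cong E (act⁻¹-act (D z) x)) (E∘D z)))

  φ-E : ∀ x w → φ x ⟨$⟩ʳ E w ≡ E (act w x)
  φ-E x w = cong (λ u → E (act u x)) (D∘E w)

  φ-hom : ∀ x y → φ (x ·W y) ≈ₚ φ x ∘ₚ φ y
  φ-hom x y z = trans (cong E (act-·W (D z) x y)) (sym (φ-E y (act (D z) x)))

  φ-cong : ∀ {x y} → x ≈W y → φ x ≈ₚ φ y
  φ-cong x≈y z = cong E (act-cong (D z) x≈y)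

  φ-ε : φ εW ≈ₚ idₚ
  φ-ε z = trans (cong E (act-ε (D z))) (E∘D z)

  φ-⁻¹ : ∀ x → φ (x ⁻¹W) ≈ₚ flip (φ x)
  φ-⁻¹ x z = begin
    φ (x ⁻¹W) ⟨$⟩ʳ z                ≡⟨ cong (φ (x ⁻¹W) ⟨$⟩ʳ_) (inverseʳ (φ x)) ⟨
    φ (x ⁻¹W) ⟨$⟩ʳ (φ x ⟨$⟩ʳ w)     ≡⟨ φ-hom x (x ⁻¹W) w ⟨
    φ (x ·W x ⁻¹W) ⟨$⟩ʳ w          ≡⟨ φ-cong (·W-inverseʳ x) w ⟩
    φ εW ⟨$⟩ʳ w                    ≡⟨ φ-ε w ⟩
    w                              ∎
    where
    open ≡-Reasoning
    w : Fin n
    w = φ x ⟨$⟩ˡ z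

  E-injective : ∀ {w w′} → E w ≡ E w′ → w ≡ w′
  E-injective {w} {w′} eq = trans (sym (D∘E w)) (trans (cong D eq) (D∘E w′))

  φ-injective : ∀ x y → φ x ≈ₚ φ y → x ≈W y
  φ-injective x y φx≈φy =
    (λ p → cong proj₁ (act-agrees p false)) , (λ p → cong proj₁ (act-agrees p true)) ,
    cong proj₂ (act-agrees fzero false)
    where
    act-agrees : ∀ p c → act (p , c) x ≡ act (p , c) y
    act-agrees p c = E-injective (trans (sym (φ-E x (p , c))) (trans (φx≈φy (E (p , c))) (φ-E y (p , c))))

⟨⟩∋-mono : ∀ {n r} {ρ : Fin r → Perm n} {I J : Subset r} → I ⊆ J → ∀ {π} → ⟨ ρ ∣ I ⟩∋ π → ⟨ ρ ∣ J ⟩∋ π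
⟨⟩∋-mono I⊆J gen-id = gen-id
⟨⟩∋-mono I⊆J (gen-gen l l∈I) = gen-gen l (I⊆J l∈I)
⟨⟩∋-mono I⊆J (gen-inv π∈) = gen-inv (⟨⟩∋-mono I⊆J π∈)
⟨⟩∋-mono I⊆J (gen-mul π∈ σ∈) = gen-mul (⟨⟩∋-mono I⊆J π∈) (⟨⟩∋-mono I⊆J σ∈)
⟨⟩∋-mono I⊆J (gen-ext π≈σ π∈) = gen-ext π≈σ (⟨⟩∋-mono I⊆J π∈)

∉-∩ : ∀ {n} {x : Fin n} I J → x ∉ I ∩ J → x ∉ I ⊎ x ∉ J
∉-∩ {x = x} I J x∉I∩J with x ∈? I | x ∈? J
... | yes x∈I | yes x∈J = ⊥-elim (x∉I∩J (x∈p∩q⁺ (x∈I , x∈J)))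
... | no x∉I | _ = inj₁ x∉I
... | yes _ | no x∉J = inj₂ x∉J

-- The graph for r = k + 3

module _ (k : ℕ) where

  r m : ℕ
  r = 3 + k
  m = 2 + k

  -- (P , true) is w_{P+1} = r + suc P, except that (r-1 , true) is u_{r+1} = r.
  vertex : ℕ → Bool → ℕ
  vertex P false = P
  vertex P true with P ℕ.≟ m
  ... | yes _ = r
  ... | no _ = r + suc P

  vertex-m : vertex m true ≡ r
  vertex-m with m ℕ.≟ m
  ... | yes _ = refl
  ... | no m≢m = ⊥-elim (m≢m refl)

  vertex-<m : ∀ {P} → P < m → vertex P true ≡ r + suc P
  vertex-<m {P} P<m with P ℕ.≟ m
  ... | yes P≡m = ⊥-elim (ℕ.<⇒≢ P<m P≡m)
  ... | no _ = refl

  r≤vertex : ∀ P → r ≤ vertex P true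
  r≤vertex P with P ℕ.≟ m
  ... | yes _ = ℕ.≤-refl
  ... | no _ = ℕ.m≤m+n r (suc P)

  vertex<2r : ∀ {P} c → P < r → vertex P c < 2 * r
  vertex<2r false P<r = ℕ.<-≤-trans P<r (ℕ.m≤m+n r _)
  vertex<2r {P} true P<r with P ℕ.≟ m
  ... | yes _ = ℕ.m<m+n r (s≤s z≤n)
  ... | no P≢m = ℕ.+-monoʳ-< r (subst (suc P <_) (sym (ℕ.+-identityʳ r)) (s≤s (ℕ.≤∧≢⇒< (ℕ.≤-pred P<r) P≢m)))

  vertex-injective : ∀ {P Q} c c′ → P < r → Q < r → vertex P c ≡ vertex Q c′ → P ≡ Q × c ≡ c′
  vertex-injective false false _ _ eq = eq , refl
  vertex-injective {P} {Q} false true P<r _ eq = ⊥-elim (ℕ.<⇒≱ P<r (subst (r ≤_) (sym eq) (r≤vertex Q)))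
  vertex-injective {P} {Q} true false _ Q<r eq = ⊥-elim (ℕ.<⇒≱ Q<r (subst (r ≤_) eq (r≤vertex P)))
  vertex-injective {P} {Q} true true _ _ eq with P ℕ.≟ m | Q ℕ.≟ m
  ... | yes P≡m | yes Q≡m = trans P≡m (sym Q≡m) , refl
  ... | yes _ | no _ = ⊥-elim (ℕ.<⇒≢ (ℕ.m<m+n r (s≤s z≤n)) eq)
  ... | no _ | yes _ = ⊥-elim (ℕ.<⇒≢ (ℕ.m<m+n r (s≤s z≤n)) (sym eq))
  ... | no _ | no _ = ℕ.suc-injective (ℕ.+-cancelˡ-≡ r _ _ eq) , refl

  vertex-surjective : ∀ z → z < 2 * r → Σ (Fin r × Bool) λ (p , c) → vertex (toℕ p) c ≡ z
  vertex-surjective z z<2r with ℕ.<-cmp z r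
  ... | tri< z<r _ _ = (fromℕ< z<r , false) , toℕ-fromℕ< z<r
  ... | tri≈ _ refl _ = (fromℕ m , true) , trans (cong (λ P → vertex P true) (toℕ-fromℕ m)) vertex-m
  ... | tri> _ _ r<z with ℕ.m≤n⇒∃[o]m+o≡n r<z
  ...   | t , refl = (fromℕ< (ℕ.m<n⇒m<1+n t<m) , true) ,
    trans (cong (λ P → vertex P true) (toℕ-fromℕ< (ℕ.m<n⇒m<1+n t<m))) (trans (vertex-<m t<m) (ℕ.+-suc r t))
    where
    t<m : t < m
    t<m = ℕ.≤-pred (ℕ.+-cancelˡ-< r (suc t) r
            (subst₂ _<_ (sym (ℕ.+-suc r t)) (cong (r +_) (ℕ.+-identityʳ r)) z<2r))

  encode : Fin r × Bool → Fin (2 * r)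
  encode (p , c) = fromℕ< (vertex<2r c (toℕ<n p))

  toℕ-encode : ∀ p c → toℕ (encode (p , c)) ≡ vertex (toℕ p) c
  toℕ-encode p c = toℕ-fromℕ< (vertex<2r c (toℕ<n p))

  encode-injective : ∀ {w w′} → encode w ≡ encode w′ → w ≡ w′
  encode-injective {p , c} {q , c′} eq
    with vertex-injective c c′ (toℕ<n p) (toℕ<n q) (trans (sym (toℕ-encode p c)) (trans (cong toℕ eq) (toℕ-encode q c′)))
  ... | p≡q , refl = cong (_, c) (toℕ-injective p≡q)

  decode : Fin (2 * r) → Fin r × Bool
  decode z = proj₁ (vertex-surjective (toℕ z) (toℕ<n z))

  encode-decode : ∀ z → encode (decode z) ≡ z
  encode-decode z = toℕ-injective (trans (toℕ-encode p c) (proj₂ (vertex-surjective (toℕ z) (toℕ<n z))))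
    where
    p : Fin r
    p = proj₁ (decode z)
    c : Bool
    c = proj₂ (decode z)

  decode-encode : ∀ w → decode (encode w) ≡ w
  decode-encode w = encode-injective (encode-decode (encode w))

  open Representation {m} encode decode encode-decode decode-encode public

  ρ : Fin r → Perm (2 * r)
  ρ = edgeInvolution (𝒢 r)

  move : ℕ → ℕ → ℕ
  move = swapAlong (graphEdgesℕ r)

  edges-inRange : All (InRange (2 * r) r) (graphEdgesℕ r)
  edges-inRange =
    All.++⁺ (All.map⁺ (All.applyUpTo⁺₁ _ r u-edge))
    (All.++⁺ (All.map⁺ (All.applyUpTo⁺₁ _ (suc k) w-edge)) (All.map⁺ (All.applyUpTo⁺₁ _ m rung)))
    where
    <r⇒<2r : ∀ {x} → x < r → x < 2 * r
    <r⇒<2r x<r = ℕ.<-≤-trans x<r (ℕ.m≤m+n r _)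
    r+<2r : ∀ {x} → x < r → r + x < 2 * r
    r+<2r {x} x<r = ℕ.+-monoʳ-< r (subst (x <_) (sym (ℕ.+-identityʳ r)) x<r)
    u-edge : ∀ {i} → i < r → InRange (2 * r) r (i , i , suc i)
    u-edge i<r = i<r , <r⇒<2r i<r , ℕ.≤-<-trans i<r (ℕ.m<m+n r (s≤s z≤n))
    w-edge : ∀ {i} → i < suc k → InRange (2 * r) r (i , r + suc i , r + suc (suc i))
    w-edge i<1+k = ℕ.<-trans i<1+k (ℕ.<-trans (ℕ.n<1+n _) (ℕ.n<1+n _)) ,
                   r+<2r (s≤s (ℕ.<-trans i<1+k (ℕ.n<1+n _))) , r+<2r (s≤s (s≤s i<1+k))
    rung : ∀ {i} → i < m → InRange (2 * r) r (m , i , r + suc i)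
    rung i<m = ℕ.≤-refl , <r⇒<2r (ℕ.<-trans i<m (ℕ.n<1+n _)) , r+<2r (s≤s i<m)

  toℕ-ρ : ∀ l z → toℕ (ρ l ⟨$⟩ʳ z) ≡ move (toℕ l) (toℕ z)
  toℕ-ρ = toℕ-edgeInvolution-mkEdges (graphEdgesℕ r) edges-inRange

  move-split : ∀ L x → move L x ≡
    swapAlong (rungs m r m) L (swapAlong (path (λ i → r + suc i) (suc k)) L (swapAlong (path id r) L x))
  move-split L x =
    trans (foldl-++ (swapAt L) x (path id r) _) (foldl-++ (swapAt L) _ (path (λ i → r + suc i) (suc k)) (rungs m r m))

  private
    rungs-unlabelled : ∀ {L} → m ≢ L → ∀ x → swapAlong (rungs m r m) L x ≡ x
    rungs-unlabelled m≢L = swapAlong-unlabelled m≢L (λ i → i , r + suc i) (upTo m)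

  move-diagonal : ∀ {L} → L ≤ k → ∀ x → move L x ≡ swapℕ (r + suc L) (r + suc (suc L)) (swapℕ L (suc L) x)
  move-diagonal {L} L≤k x = begin
    move L x                                                  ≡⟨ move-split L x ⟩
    swapAlong (rungs m r m) L (swapAlong (path (λ i → r + suc i) (suc k)) L (swapAlong (path id r) L x))
      ≡⟨ rungs-unlabelled (ℕ.>⇒≢ (s≤s (ℕ.m≤n⇒m≤1+n L≤k))) _ ⟩
    swapAlong (path (λ i → r + suc i) (suc k)) L (swapAlong (path id r) L x)
      ≡⟨ swapAlong-path-< (λ i → r + suc i) _ (s≤s L≤k) ⟩
    swapℕ (r + suc L) (r + suc (suc L)) (swapAlong (path id r) L x)
      ≡⟨ cong (swapℕ _ _) (swapAlong-path-< id x (s≤s (ℕ.m≤n⇒m≤1+n (ℕ.m≤n⇒m≤1+n L≤k)))) ⟩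
    swapℕ (r + suc L) (r + suc (suc L)) (swapℕ L (suc L) x) ∎
    where open ≡-Reasoning

  move-top : ∀ x → move (suc k) x ≡ swapℕ (suc k) m x
  move-top x = begin
    move (suc k) x                                            ≡⟨ move-split (suc k) x ⟩
    swapAlong (rungs m r m) (suc k) (swapAlong (path (λ i → r + suc i) (suc k)) (suc k) (swapAlong (path id r) (suc k) x))
      ≡⟨ rungs-unlabelled (ℕ.>⇒≢ (ℕ.n<1+n (suc k))) _ ⟩
    swapAlong (path (λ i → r + suc i) (suc k)) (suc k) (swapAlong (path id r) (suc k) x)
      ≡⟨ swapAlong-path-≥ (λ i → r + suc i) {suc k} _ ℕ.≤-refl ⟩
    swapAlong (path id r) (suc k) x                           ≡⟨ swapAlong-path-< id x (ℕ.m≤n⇒m≤1+n ℕ.≤-refl) ⟩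
    swapℕ (suc k) m x                                         ∎
    where open ≡-Reasoning

  move-last : ∀ x → move m x ≡ swapAlong (rungs m r m) m (swapℕ m r x)
  move-last x = begin
    move m x                                                  ≡⟨ move-split m x ⟩
    swapAlong (rungs m r m) m (swapAlong (path (λ i → r + suc i) (suc k)) m (swapAlong (path id r) m x))
      ≡⟨ cong (swapAlong (rungs m r m) m) (swapAlong-path-≥ (λ i → r + suc i) {suc k} _ (ℕ.n≤1+n _)) ⟩
    swapAlong (rungs m r m) m (swapAlong (path id r) m x)     ≡⟨ cong (swapAlong (rungs m r m) m) (swapAlong-path-< id x ℕ.≤-refl) ⟩
    swapAlong (rungs m r m) m (swapℕ m r x)                   ∎
    where open ≡-Reasoning

  private
    L<r : ∀ {L} → L ≤ k → suc L < r
    L<r L≤k = s≤s (s≤s (ℕ.m≤n⇒m≤1+n L≤k))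

    m≢L : ∀ {L} → L ≤ k → m ≢ L
    m≢L L≤k = ℕ.>⇒≢ (s≤s (ℕ.m≤n⇒m≤1+n L≤k))

    m≢1+L : ∀ {L} → L ≤ k → m ≢ suc L
    m≢1+L L≤k = ℕ.>⇒≢ (s≤s (s≤s L≤k))

    r<r+1+x : ∀ {x} → r < r + suc x
    r<r+1+x = ℕ.m<m+n r (s≤s z≤n)

    swapℕ-copy₂-vertex : ∀ {L P} → L ≤ k → P < r →
      swapℕ (r + suc L) (r + suc (suc L)) (vertex P true) ≡ vertex (swapℕ L (suc L) P) true
    swapℕ-copy₂-vertex {L} {P} L≤k P<r with ℕ.m<1+n⇒m<n∨m≡n P<r
    ... | inj₂ refl = begin
      swapℕ (r + suc L) (r + suc (suc L)) (vertex m true) ≡⟨ cong (swapℕ (r + suc L) (r + suc (suc L))) vertex-m ⟩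
      swapℕ (r + suc L) (r + suc (suc L)) r              ≡⟨ swapℕ-below r<r+1+x r<r+1+x ⟩
      r                                                   ≡⟨ vertex-m ⟨
      vertex m true
        ≡⟨ cong (λ P → vertex P true) (swapℕ-other L (suc L) (m≢L L≤k) (m≢1+L L≤k)) ⟨
      vertex (swapℕ L (suc L) m) true                     ∎
      where open ≡-Reasoning
    ... | inj₁ P<m = begin
      swapℕ (r + suc L) (r + suc (suc L)) (vertex P true) ≡⟨ cong (swapℕ (r + suc L) (r + suc (suc L))) (vertex-<m P<m) ⟩
      swapℕ (r + suc L) (r + suc (suc L)) (r + suc P)    ≡⟨ swapℕ-+ r (suc L) (suc (suc L)) (suc P) ⟩
      r + swapℕ (suc L) (suc (suc L)) (suc P)            ≡⟨ cong (r +_) (swapℕ-+ 1 L (suc L) P) ⟩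
      r + suc (swapℕ L (suc L) P)                         ≡⟨ vertex-<m Q<m ⟨
      vertex (swapℕ L (suc L) P) true                     ∎
      where
      open ≡-Reasoning
      Q<m : swapℕ L (suc L) P < m
      Q<m = ℕ.≤∧≢⇒< (ℕ.≤-pred (swapℕ-< (ℕ.<-trans (ℕ.n<1+n L) (L<r L≤k)) (L<r L≤k) P<r))
                    (λ Q≡m → ℕ.<⇒≢ P<m (swapℕ-fixed⁻¹ Q≡m (m≢L L≤k) (m≢1+L L≤k)))

  move-diagonal-vertex : ∀ {L P} → L ≤ k → P < r → ∀ c → move L (vertex P c) ≡ vertex (swapℕ L (suc L) P) c
  move-diagonal-vertex {L} {P} L≤k P<r false = begin
    move L P                                                        ≡⟨ move-diagonal L≤k P ⟩
    swapℕ (r + suc L) (r + suc (suc L)) (swapℕ L (suc L) P)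
      ≡⟨ swapℕ-below (ℕ.<-≤-trans Q<r (ℕ.m≤m+n r _)) (ℕ.<-≤-trans Q<r (ℕ.m≤m+n r _)) ⟩
    swapℕ L (suc L) P                                               ∎
    where
    open ≡-Reasoning
    Q<r : swapℕ L (suc L) P < r
    Q<r = swapℕ-< (ℕ.<-trans (ℕ.n<1+n L) (L<r L≤k)) (L<r L≤k) P<r
  move-diagonal-vertex {L} {P} L≤k P<r true = begin
    move L (vertex P true)                                          ≡⟨ move-diagonal L≤k (vertex P true) ⟩
    swapℕ (r + suc L) (r + suc (suc L)) (swapℕ L (suc L) (vertex P true))
      ≡⟨ cong (swapℕ (r + suc L) (r + suc (suc L)))
              (swapℕ-beyond (ℕ.<-≤-trans (ℕ.<-trans (ℕ.n<1+n L) (L<r L≤k)) (r≤vertex P))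
                            (ℕ.<-≤-trans (L<r L≤k) (r≤vertex P))) ⟩
    swapℕ (r + suc L) (r + suc (suc L)) (vertex P true)             ≡⟨ swapℕ-copy₂-vertex L≤k P<r ⟩
    vertex (swapℕ L (suc L) P) true                                 ∎
    where open ≡-Reasoning

  move-top-vertex-true : ∀ P → move (suc k) (vertex P true) ≡ vertex P true
  move-top-vertex-true P = trans (move-top _)
    (swapℕ-beyond (ℕ.<-≤-trans (ℕ.<-trans (ℕ.n<1+n _) (ℕ.n<1+n m)) (r≤vertex P)) (ℕ.<-≤-trans (ℕ.n<1+n m) (r≤vertex P)))

  move-last-vertex-false : ∀ {P} → P < r → move m (vertex P false) ≡ vertex P true
  move-last-vertex-false {P} P<r with ℕ.m<1+n⇒m<n∨m≡n P<r
  ... | inj₂ refl = begin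
    move m m                                   ≡⟨ move-last m ⟩
    swapAlong (rungs m r m) m (swapℕ m r m)    ≡⟨ cong (swapAlong (rungs m r m) m) (swapℕ-left m r) ⟩
    swapAlong (rungs m r m) m r                ≡⟨ swapAlong-rungs-middle m r (ℕ.n≤1+n m) ℕ.≤-refl ⟩
    r                                          ≡⟨ vertex-m ⟨
    vertex m true                              ∎
    where open ≡-Reasoning
  ... | inj₁ P<m = begin
    move m P                                   ≡⟨ move-last P ⟩
    swapAlong (rungs m r m) m (swapℕ m r P)    ≡⟨ cong (swapAlong (rungs m r m) m) (swapℕ-below P<m P<r) ⟩
    swapAlong (rungs m r m) m P                ≡⟨ swapAlong-rungs-foot m r (ℕ.n≤1+n m) P<m ⟩
    r + suc P                                  ≡⟨ vertex-<m P<m ⟨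
    vertex P true                              ∎
    where open ≡-Reasoning

  move-last-vertex-true : ∀ {P} → P < r → move m (vertex P true) ≡ P
  move-last-vertex-true {P} P<r with ℕ.m<1+n⇒m<n∨m≡n P<r
  ... | inj₂ refl = begin
    move m (vertex m true)                     ≡⟨ cong (move m) vertex-m ⟩
    move m r                                   ≡⟨ move-last r ⟩
    swapAlong (rungs m r m) m (swapℕ m r r)    ≡⟨ cong (swapAlong (rungs m r m) m) (swapℕ-right m r) ⟩
    swapAlong (rungs m r m) m m                ≡⟨ swapAlong-rungs-middle m r ℕ.≤-refl (ℕ.n≤1+n m) ⟩
    m                                          ∎
    where open ≡-Reasoning
  ... | inj₁ P<m = begin
    move m (vertex P true)                     ≡⟨ cong (move m) (vertex-<m P<m) ⟩
    move m (r + suc P)                         ≡⟨ move-last (r + suc P) ⟩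
    swapAlong (rungs m r m) m (swapℕ m r (r + suc P))
      ≡⟨ cong (swapAlong (rungs m r m) m) (swapℕ-beyond (ℕ.<-trans (ℕ.n<1+n m) r<r+1+x) r<r+1+x) ⟩
    swapAlong (rungs m r m) m (r + suc P)      ≡⟨ swapAlong-rungs-head m r (ℕ.n≤1+n m) P<m ⟩
    P                                          ∎
    where open ≡-Reasoning

  swapW : Wr r
  swapW = idₚ , idₚ , true

  left diagonal : Perm r → Wr r
  left σ = σ , idₚ , false
  diagonal σ = σ , σ , false

  top : Fin m
  top = fromℕ (suc k)

  last : Fin r
  last = fromℕ m

  generatorOf : ∀ {l : Fin r} → View l → Wr r
  generatorOf ‵fromℕ = swapW
  generatorOf (‵inj₁ ‵fromℕ) = left (adjacent top)
  generatorOf (‵inj₁ (‵inject₁ j)) = diagonal (adjacent (inject₁ j))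

  generator : Fin r → Wr r
  generator l = generatorOf (view l)

  act-diagonal : ∀ σ p c → act (p , c) (diagonal σ) ≡ (σ ⟨$⟩ʳ p , c)
  act-diagonal σ p false = refl
  act-diagonal σ p true = refl

  toℕ-top : toℕ top ≡ suc k
  toℕ-top = toℕ-fromℕ (suc k)

  move-generator : ∀ l p c → move (toℕ l) (vertex (toℕ p) c) ≡ toℕ (encode (act (p , c) (generator l)))
  move-generator l p c with view l
  move-generator _ p false | ‵fromℕ = begin
    move (toℕ (fromℕ m)) (toℕ p)            ≡⟨ cong (λ L → move L (toℕ p)) (toℕ-fromℕ m) ⟩
    move m (toℕ p)                          ≡⟨ move-last-vertex-false (toℕ<n p) ⟩
    vertex (toℕ p) true                     ≡⟨ toℕ-encode p true ⟨
    toℕ (encode (p , true))                 ∎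
    where open ≡-Reasoning
  move-generator _ p true | ‵fromℕ = begin
    move (toℕ (fromℕ m)) (vertex (toℕ p) true) ≡⟨ cong (λ L → move L (vertex (toℕ p) true)) (toℕ-fromℕ m) ⟩
    move m (vertex (toℕ p) true)               ≡⟨ move-last-vertex-true (toℕ<n p) ⟩
    toℕ p                                      ≡⟨ toℕ-encode p false ⟨
    toℕ (encode (p , false))                   ∎
    where open ≡-Reasoning
  move-generator _ p false | ‵inj₁ ‵fromℕ = begin
    move (toℕ (inject₁ top)) (toℕ p)         ≡⟨ cong (λ L → move L (toℕ p)) (trans (toℕ-inject₁ top) toℕ-top) ⟩
    move (suc k) (toℕ p)                     ≡⟨ move-top (toℕ p) ⟩
    swapℕ (suc k) m (toℕ p)                  ≡⟨ cong (λ a → swapℕ a (suc a) (toℕ p)) toℕ-top ⟨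
    swapℕ (toℕ top) (suc (toℕ top)) (toℕ p)  ≡⟨ toℕ-adjacent top p ⟨
    toℕ (adjacent top ⟨$⟩ʳ p)                 ≡⟨ toℕ-encode (adjacent top ⟨$⟩ʳ p) false ⟨
    toℕ (encode (adjacent top ⟨$⟩ʳ p , false)) ∎
    where open ≡-Reasoning
  move-generator _ p true | ‵inj₁ ‵fromℕ = begin
    move (toℕ (inject₁ top)) (vertex (toℕ p) true)
      ≡⟨ cong (λ L → move L (vertex (toℕ p) true)) (trans (toℕ-inject₁ top) toℕ-top) ⟩
    move (suc k) (vertex (toℕ p) true)             ≡⟨ move-top-vertex-true (toℕ p) ⟩
    vertex (toℕ p) true                            ≡⟨ toℕ-encode p true ⟨
    toℕ (encode (p , true))                        ∎
    where open ≡-Reasoning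
  move-generator _ p c | ‵inj₁ (‵inject₁ j) = begin
    move (toℕ (inject₁ (inject₁ j))) (vertex (toℕ p) c)
      ≡⟨ cong (λ L → move L (vertex (toℕ p) c)) (trans (toℕ-inject₁ (inject₁ j)) (toℕ-inject₁ j)) ⟩
    move (toℕ j) (vertex (toℕ p) c)                        ≡⟨ move-diagonal-vertex (ℕ.≤-pred (toℕ<n j)) (toℕ<n p) c ⟩
    vertex (swapℕ (toℕ j) (suc (toℕ j)) (toℕ p)) c
      ≡⟨ cong (λ a → vertex (swapℕ a (suc a) (toℕ p)) c) (toℕ-inject₁ j) ⟨
    vertex (swapℕ (toℕ (inject₁ j)) (suc (toℕ (inject₁ j))) (toℕ p)) c
      ≡⟨ cong (λ x → vertex x c) (toℕ-adjacent (inject₁ j) p) ⟨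
    vertex (toℕ (adjacent (inject₁ j) ⟨$⟩ʳ p)) c           ≡⟨ toℕ-encode (adjacent (inject₁ j) ⟨$⟩ʳ p) c ⟨
    toℕ (encode (adjacent (inject₁ j) ⟨$⟩ʳ p , c))          ≡⟨ cong (toℕ ∘ encode) (act-diagonal (adjacent (inject₁ j)) p c) ⟨
    toℕ (encode (act (p , c) (diagonal (adjacent (inject₁ j))))) ∎
    where open ≡-Reasoning

  ρ-encode : ∀ l w → ρ l ⟨$⟩ʳ encode w ≡ encode (act w (generator l))
  ρ-encode l (p , c) = toℕ-injective (begin
    toℕ (ρ l ⟨$⟩ʳ encode (p , c))             ≡⟨ toℕ-ρ l (encode (p , c)) ⟩
    move (toℕ l) (toℕ (encode (p , c)))       ≡⟨ cong (move (toℕ l)) (toℕ-encode p c) ⟩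
    move (toℕ l) (vertex (toℕ p) c)           ≡⟨ move-generator l p c ⟩
    toℕ (encode (act (p , c) (generator l)))  ∎)
    where open ≡-Reasoning

  ρ≈φ-generator : ∀ l → ρ l ≈ₚ φ (generator l)
  ρ≈φ-generator l z = trans (cong (ρ l ⟨$⟩ʳ_) (sym (encode-decode z))) (ρ-encode l (decode z))

  -- Parabolic subgroups

  AgreeingPrefix : Perm r → Perm r → Fin m → Set
  AgreeingPrefix a b i = PreservesPrefix a i × PreservesPrefix b i × (∀ p → toℕ p ≤ toℕ i → a ⟨$⟩ʳ p ≡ b ⟨$⟩ʳ p)

  Parabolic : Subset r → Wr r → Set
  Parabolic I (a , b , s) =
    (∀ i → inject₁ i ∉ I → AgreeingPrefix a b i) × (last ∉ I → s ≡ false × b ⟨$⟩ʳ last ≡ last)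

  module _ (I : Subset r) where

    parabolic-ε : Parabolic I εW
    parabolic-ε = (λ i _ → PreservesPrefix-id i , PreservesPrefix-id i , λ _ _ → refl) , (λ _ → refl , refl)

    parabolic-≈ : ∀ {x y} → x ≈W y → Parabolic I x → Parabolic I y
    parabolic-≈ {a , b , s} {c , d , t} (a≈c , b≈d , refl) (cuts , unswapped) =
      (λ i i∉I → let (a-pres , b-pres , a≡b) = cuts i i∉I in
         PreservesPrefix-≈ {π = a} {σ = c} a≈c a-pres , PreservesPrefix-≈ {π = b} {σ = d} b≈d b-pres ,
         λ p p≤i → trans (sym (a≈c p)) (trans (a≡b p p≤i) (b≈d p))) ,
      (λ last∉I → proj₁ (unswapped last∉I) , trans (sym (b≈d last)) (proj₂ (unswapped last∉I)))

    parabolic-· : ∀ x y → Parabolic I x → Parabolic I y → Parabolic I (x ·W y)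
    parabolic-· (a , b , false) (c , d , t) (cutsˣ , unswappedˣ) (cutsʸ , unswappedʸ) =
      (λ i i∉I → let (a-pres , b-pres , a≡b) = cutsˣ i i∉I ; (c-pres , d-pres , c≡d) = cutsʸ i i∉I in
         PreservesPrefix-∘ {π = a} {σ = c} a-pres c-pres , PreservesPrefix-∘ {π = b} {σ = d} b-pres d-pres ,
         λ p p≤i → trans (c≡d (a ⟨$⟩ʳ p) (to (a-pres p) p≤i)) (cong (d ⟨$⟩ʳ_) (a≡b p p≤i))) ,
      (λ last∉I → proj₁ (unswappedʸ last∉I) ,
         trans (cong (d ⟨$⟩ʳ_) (proj₂ (unswappedˣ last∉I))) (proj₂ (unswappedʸ last∉I)))
    parabolic-· (a , b , true) (c , d , t) (cutsˣ , unswappedˣ) (cutsʸ , _) =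
      (λ i i∉I → let (a-pres , b-pres , a≡b) = cutsˣ i i∉I ; (c-pres , d-pres , c≡d) = cutsʸ i i∉I in
         PreservesPrefix-∘ {π = a} {σ = d} a-pres d-pres , PreservesPrefix-∘ {π = b} {σ = c} b-pres c-pres ,
         λ p p≤i → trans (sym (c≡d (a ⟨$⟩ʳ p) (to (a-pres p) p≤i))) (cong (c ⟨$⟩ʳ_) (a≡b p p≤i))) ,
      (λ last∉I → case proj₁ (unswappedˣ last∉I) of λ ())

    parabolic-⁻¹ : ∀ x → Parabolic I x → Parabolic I (x ⁻¹W)
    parabolic-⁻¹ (a , b , false) (cuts , unswapped) =
      (λ i i∉I → let (a-pres , b-pres , a≡b) = cuts i i∉I in
         PreservesPrefix-flip {π = a} a-pres , PreservesPrefix-flip {π = b} b-pres , flip-agree a b a-pres a≡b) ,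
      (λ last∉I → refl , trans (cong (b ⟨$⟩ˡ_) (sym (proj₂ (unswapped last∉I)))) (inverseˡ b))
    parabolic-⁻¹ (a , b , true) (cuts , unswapped) =
      (λ i i∉I → let (a-pres , b-pres , a≡b) = cuts i i∉I in
         PreservesPrefix-flip {π = b} b-pres , PreservesPrefix-flip {π = a} a-pres ,
         λ p p≤i → sym (flip-agree a b a-pres a≡b p p≤i)) ,
      (λ last∉I → case proj₁ (unswapped last∉I) of λ ())

  parabolic-⊤ : ∀ x → Parabolic ⊤ x
  parabolic-⊤ (a , b , s) = (λ i i∉⊤ → ⊥-elim (i∉⊤ ∈⊤)) , (λ last∉⊤ → ⊥-elim (last∉⊤ ∈⊤))

  parabolic-∩ : ∀ I J x → Parabolic I x → Parabolic J x → Parabolic (I ∩ J) x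
  parabolic-∩ I J (a , b , s) (cutsᴵ , unswappedᴵ) (cutsᴶ , unswappedᴶ) =
    (λ i i∉I∩J → [ cutsᴵ i , cutsᴶ i ]′ (∉-∩ I J i∉I∩J)) ,
    (λ last∉I∩J → [ unswappedᴵ , unswappedᴶ ]′ (∉-∩ I J last∉I∩J))

  toℕ-last : toℕ last ≡ m
  toℕ-last = toℕ-fromℕ m

  parabolic-generator : ∀ I l → l ∈ I → Parabolic I (generator l)
  parabolic-generator I l l∈I with view l
  ... | ‵fromℕ = (λ i _ → PreservesPrefix-id i , PreservesPrefix-id i , λ _ _ → refl) , (λ last∉I → ⊥-elim (last∉I l∈I))
  ... | ‵inj₁ ‵fromℕ =
    (λ i i∉I → adjacent-preservesPrefix (top≢ i∉I) , PreservesPrefix-id i , fixes-below i∉I) , (λ _ → refl , refl)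
    where
    top≢ : ∀ {i} → inject₁ i ∉ I → toℕ top ≢ toℕ i
    top≢ i∉I eq = i∉I (subst (λ j → inject₁ j ∈ I) (toℕ-injective eq) l∈I)
    fixes-below : ∀ {i} → inject₁ i ∉ I → ∀ p → toℕ p ≤ toℕ i → adjacent top ⟨$⟩ʳ p ≡ p
    fixes-below {i} i∉I p p≤i = adjacent-other (ℕ.<⇒≢ (subst (toℕ p <_) (sym toℕ-top) p<1+k))
                                               (ℕ.<⇒≢ (subst (λ t → toℕ p < suc t) (sym toℕ-top) (ℕ.m<n⇒m<1+n p<1+k)))
      where
      p<1+k : toℕ p < suc k
      p<1+k = ℕ.≤-<-trans p≤i (ℕ.≤∧≢⇒< (ℕ.≤-pred (toℕ<n i)) (λ eq → top≢ i∉I (trans toℕ-top (sym eq))))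
  ... | ‵inj₁ (‵inject₁ j) =
    (λ i i∉I → adjacent-preservesPrefix (j≢ i∉I) , adjacent-preservesPrefix (j≢ i∉I) , λ _ _ → refl) ,
    (λ _ → refl , adjacent-other {i = inject₁ j} (ℕ.>⇒≢ (ℕ.m<n⇒m<1+n j<1+k) ∘ trans (sym toℕ-last))
                                                  (ℕ.>⇒≢ (s≤s j<1+k) ∘ trans (sym toℕ-last)))
    where
    j≢ : ∀ {i} → inject₁ i ∉ I → toℕ (inject₁ j) ≢ toℕ i
    j≢ i∉I eq = i∉I (subst (λ i → inject₁ i ∈ I) (toℕ-injective eq) l∈I)
    j≤k : toℕ (inject₁ j) ≤ k
    j≤k = subst (_≤ k) (sym (toℕ-inject₁ j)) (ℕ.≤-pred (toℕ<n j))
    j<1+k : toℕ (inject₁ j) < suc k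
    j<1+k = s≤s j≤k

  parabolic-sound : ∀ I {π} → ⟨ ρ ∣ I ⟩∋ π → Σ (Wr r) λ x → φ x ≈ₚ π × Parabolic I x
  parabolic-sound I gen-id = εW , φ-ε , parabolic-ε I
  parabolic-sound I (gen-gen l l∈I) = generator l , (λ z → sym (ρ≈φ-generator l z)) , parabolic-generator I l l∈I
  parabolic-sound I (gen-inv {π} π∈) with parabolic-sound I π∈
  ... | x , φx≈π , x-parabolic =
    x ⁻¹W , (λ z → trans (φ-⁻¹ x z) (flip-≈ {π = φ x} {σ = π} φx≈π z)) , parabolic-⁻¹ I x x-parabolic
  parabolic-sound I (gen-mul {π} {σ} π∈ σ∈) with parabolic-sound I π∈ | parabolic-sound I σ∈
  ... | x , φx≈π , x-parabolic | y , φy≈σ , y-parabolic =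
    x ·W y , (λ z → trans (φ-hom x y z) (trans (φy≈σ _) (cong (σ ⟨$⟩ʳ_) (φx≈π z)))) , parabolic-· I x y x-parabolic y-parabolic
  parabolic-sound I (gen-ext π≈σ π∈) with parabolic-sound I π∈
  ... | x , φx≈π , x-parabolic = x , (λ z → trans (φx≈π z) (π≈σ z)) , x-parabolic

  module _ (I : Subset r) where

    -- A record rather than a synonym, so that x can be inferred from Generated x.
    record Generated (x : Wr r) : Set where
      constructor generated
      field φ∈ : ⟨ ρ ∣ I ⟩∋ φ x

    open Generated public

    generated-ε : Generated εW
    generated-ε = generated (gen-ext (λ z → sym (φ-ε z)) gen-id)

    generated-· : ∀ {x y} → Generated x → Generated y → Generated (x ·W y)
    generated-· {x} {y} (generated x∈) (generated y∈) = generated (gen-ext (λ z → sym (φ-hom x y z)) (gen-mul x∈ y∈))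

    generated-⁻¹ : ∀ {x} → Generated x → Generated (x ⁻¹W)
    generated-⁻¹ {x} (generated x∈) = generated (gen-ext (λ z → sym (φ-⁻¹ x z)) (gen-inv x∈))

    generated-≈ : ∀ {x y} → x ≈W y → Generated x → Generated y
    generated-≈ x≈y (generated x∈) = generated (gen-ext (φ-cong x≈y) x∈)

    generated-generator : ∀ {l} → l ∈ I → Generated (generator l)
    generated-generator {l} l∈I = generated (gen-ext (ρ≈φ-generator l) (gen-gen l l∈I))

    generated-swap : last ∈ I → Generated swapW
    generated-swap last∈I = subst Generated (cong generatorOf (view-fromℕ m)) (generated-generator last∈I)

    generated-left-top : inject₁ top ∈ I → Generated (left (adjacent top))
    generated-left-top top∈I =
      subst Generated (cong generatorOf (trans (view-inject₁ top) (cong ‵inj₁ (view-fromℕ (suc k))))) (generated-generator top∈I)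

    generated-diagonal : ∀ j → inject₁ (inject₁ j) ∈ I → Generated (diagonal (adjacent (inject₁ j)))
    generated-diagonal j j∈I =
      subst Generated (cong generatorOf (trans (view-inject₁ (inject₁ j)) (cong ‵inj₁ (view-inject₁ j)))) (generated-generator j∈I)

    diagonal-isSubgroup : IsSubgroup (λ σ → Generated (diagonal σ))
    diagonal-isSubgroup = record
      { id-closed   = generated-ε
      ; ∘-closed    = generated-·
      ; flip-closed = generated-⁻¹
      ; ≈-closed    = λ π≈σ → generated-≈ (π≈σ , π≈σ , refl)
      }

    left-isSubgroup : IsSubgroup (λ σ → Generated (left σ))
    left-isSubgroup = record
      { id-closed   = generated-ε
      ; ∘-closed    = λ π∈ σ∈ → generated-≈ ((λ _ → refl) , (λ _ → refl) , refl) (generated-· π∈ σ∈)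
      ; flip-closed = λ π∈ → generated-≈ ((λ _ → refl) , (λ _ → refl) , refl) (generated-⁻¹ π∈)
      ; ≈-closed    = λ π≈σ → generated-≈ (π≈σ , (λ _ → refl) , refl)
      }

    -- ρ_{r-2} followed by its conjugate under the swap.
    generated-diagonal-top : inject₁ top ∈ I → last ∈ I → Generated (diagonal (adjacent top))
    generated-diagonal-top top∈I last∈I =
      generated-≈ ((λ _ → refl) , (λ _ → refl) , refl)
        (generated-· (generated-left-top top∈I)
          (generated-· (generated-· (generated-swap last∈I) (generated-left-top top∈I)) (generated-swap last∈I)))

    -- Only s_{r-2} needs the swap to act on both copies, see generated-diagonal-top.
    DiagonalAdjacent : Fin m → Set
    DiagonalAdjacent i = inject₁ i ∈ I × (i ≡ top → last ∈ I)

    diagonalAdjacent? : ∀ i → Dec (DiagonalAdjacent i)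
    diagonalAdjacent? i = (inject₁ i ∈? I) ×-dec ((i ≟ top) →-dec (last ∈? I))

    generated-diagonal-adjacent : ∀ i → DiagonalAdjacent i → Generated (diagonal (adjacent i))
    generated-diagonal-adjacent i (i∈I , top⇒last∈I) with view i
    ... | ‵fromℕ = generated-diagonal-top i∈I (top⇒last∈I refl)
    ... | ‵inject₁ j = generated-diagonal j i∈I

    generated-diagonal-of-parabolic : ∀ {a b s} → Parabolic I (a , b , s) → Generated (diagonal b)
    generated-diagonal-of-parabolic {b = b} (cuts , unswapped) =
      young-generation diagonal-isSubgroup diagonalAdjacent? generated-diagonal-adjacent b b-pres
      where
      b-pres : ∀ i → ¬ DiagonalAdjacent i → PreservesPrefix b i
      b-pres i ¬adjacent with inject₁ i ∈? I
      ... | no i∉I = proj₁ (proj₂ (cuts i i∉I))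
      ... | yes i∈I with last ∈? I
      ...   | yes last∈I = ⊥-elim (¬adjacent (i∈I , λ _ → last∈I))
      ...   | no last∉I with i ≟ top
      ...     | yes refl = fixesLast⇒preservesPrefix {σ = b} (proj₂ (unswapped last∉I))
      ...     | no i≢top = ⊥-elim (¬adjacent (i∈I , ⊥-elim ∘ i≢top))

    -- s_i on the first copy alone is reached from ρ_{r-2} by conjugating with the diagonal
    -- s_i, …, s_{r-3}, so it needs every label from i to r-2.
    LeftAdjacent : Fin m → Set
    LeftAdjacent i = ∀ j → toℕ i ≤ toℕ j → inject₁ j ∈ I

    leftAdjacent? : ∀ i → Dec (LeftAdjacent i)
    leftAdjacent? i = all? (λ j → (toℕ i ℕ.≤? toℕ j) →-dec (inject₁ j ∈? I))

    private
      module ThreePoints (j : Fin (suc k)) where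
        A B : Fin r
        A = inject₁ (inject₁ j)
        B = fsuc (inject₁ j)

        j≤k : toℕ (inject₁ j) ≤ k
        j≤k = subst (_≤ k) (sym (toℕ-inject₁ j)) (ℕ.≤-pred (toℕ<n j))

        A≢B : A ≢ B
        A≢B eq = ℕ.<⇒≢ (ℕ.n<1+n (toℕ (inject₁ j))) (trans (sym (toℕ-inject₁ (inject₁ j))) (cong toℕ eq))

        B≢last : B ≢ last
        B≢last eq = ℕ.<⇒≢ (s≤s (s≤s j≤k)) (trans (cong toℕ eq) toℕ-last)

        A≢last : A ≢ last
        A≢last eq = ℕ.<⇒≢ (s≤s (ℕ.m≤n⇒m≤1+n (subst (_≤ k) (sym (toℕ-inject₁ (inject₁ j))) j≤k)))
                          (trans (cong toℕ eq) toℕ-last)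

    leftAdjacent-suc : ∀ {j} → LeftAdjacent (inject₁ j) → LeftAdjacent (fsuc j)
    leftAdjacent-suc {j} left-adjacent j′ 1+j≤j′ =
      left-adjacent j′ (ℕ.≤-trans (subst (_≤ suc (toℕ j)) (sym (toℕ-inject₁ j)) (ℕ.n≤1+n _)) 1+j≤j′)

    generated-left-toLast : ∀ i → LeftAdjacent i → Generated (left (transpose (inject₁ i) last))
    generated-left-toLast i = descend (suc k ∸ toℕ i) i (ℕ.m+[n∸m]≡n (ℕ.≤-pred (toℕ<n i)))
      where
      descend : ∀ d i → toℕ i + d ≡ suc k → LeftAdjacent i → Generated (left (transpose (inject₁ i) last))
      descend zero i i+0≡1+k left-adjacent =
        subst (λ i → Generated (left (transpose (inject₁ i) last))) (sym i≡top)
              (generated-left-top (left-adjacent top (ℕ.≤-reflexive (cong toℕ i≡top))))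
        where
        i≡top : i ≡ top
        i≡top = toℕ-injective (trans (sym (ℕ.+-identityʳ (toℕ i))) (trans i+0≡1+k (sym toℕ-top)))
      descend (suc d) i i+1+d≡1+k left-adjacent with view i
      ... | ‵fromℕ = ⊥-elim (ℕ.m+1+n≢m (suc k) (trans (cong (_+ suc d) (sym toℕ-top)) i+1+d≡1+k))
      ... | ‵inject₁ j =
        generated-≈ (transpose-conjugate A≢B B≢last A≢last , transpose-involutive A B , refl)
          (generated-· (generated-· s∈ B↔last) s∈)
        where
        open ThreePoints j
        s∈ : Generated (diagonal (adjacent (inject₁ j)))
        s∈ = generated-diagonal j (left-adjacent (inject₁ j) ℕ.≤-refl)
        B↔last : Generated (left (transpose B last))
        B↔last = descend d (fsuc j)
          (trans (sym (ℕ.+-suc (toℕ j) d)) (trans (cong (_+ suc d) (sym (toℕ-inject₁ j))) i+1+d≡1+k))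
          (leftAdjacent-suc left-adjacent)

    -- (i , i+1) = (i , r-1) (i+1 , r-1) (i , r-1), each factor acting on the first copy.
    generated-left-adjacent : ∀ i → LeftAdjacent i → Generated (left (adjacent i))
    generated-left-adjacent i left-adjacent with view i
    ... | ‵fromℕ = generated-left-top (left-adjacent top ℕ.≤-refl)
    ... | ‵inject₁ j =
      generated-≈ ((λ x → trans (cong (transpose A last ⟨$⟩ʳ_) (transpose-sym B last (transpose A last ⟨$⟩ʳ x)))
                                (transpose-conjugate A≢last (≢-sym B≢last) A≢B x)) ,
                   (λ _ → refl) , refl)
        (generated-· (generated-· A↔last B↔last) A↔last)
      where
      open ThreePoints j
      A↔last : Generated (left (transpose A last))
      A↔last = generated-left-toLast (inject₁ j) left-adjacent
      B↔last : Generated (left (transpose B last))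
      B↔last = generated-left-toLast (fsuc j) (leftAdjacent-suc left-adjacent)

    generated-left-of-parabolic : ∀ {a b s} → Parabolic I (a , b , s) → Generated (left (a ∘ₚ flip b))
    generated-left-of-parabolic {a} {b} (cuts , _) =
      young-generation left-isSubgroup leftAdjacent? generated-left-adjacent (a ∘ₚ flip b) ab⁻¹-pres
      where
      ab⁻¹-pres : ∀ i → ¬ LeftAdjacent i → PreservesPrefix (a ∘ₚ flip b) i
      ab⁻¹-pres i ¬left-adjacent
        with ¬∀⟶∃¬ m _ (λ j → (toℕ i ℕ.≤? toℕ j) →-dec (inject₁ j ∈? I)) ¬left-adjacent
      ... | j , ¬[i≤j⇒j∈I] with toℕ i ℕ.≤? toℕ j | inject₁ j ∈? I
      ...   | no i≰j | _ = ⊥-elim (¬[i≤j⇒j∈I] (⊥-elim ∘ i≰j))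
      ...   | yes _ | yes j∈I = ⊥-elim (¬[i≤j⇒j∈I] (λ _ → j∈I))
      ...   | yes i≤j | no j∉I = fixesPrefix⇒preservesPrefix {σ = a ∘ₚ flip b} i≤j
        λ p p≤j → trans (cong (b ⟨$⟩ˡ_) (proj₂ (proj₂ (cuts j j∉I)) p p≤j)) (inverseˡ b)

    parabolic-complete : ∀ x → Parabolic I x → Generated x
    parabolic-complete (a , b , false) x-parabolic =
      generated-≈ ((λ _ → inverseʳ b) , (λ _ → refl) , refl)
        (generated-· (generated-left-of-parabolic {a} {b} x-parabolic) (generated-diagonal-of-parabolic {a} {b} x-parabolic))
    parabolic-complete (a , b , true) (cuts , unswapped) with last ∈? I
    ... | no last∉I = case proj₁ (unswapped last∉I) of λ ()
    ... | yes last∈I =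
      generated-≈ ((λ _ → refl) , (λ _ → refl) , refl)
        (generated-· (parabolic-complete (a , b , false) (cuts , λ last∉I → ⊥-elim (last∉I last∈I))) (generated-swap last∈I))

  generator-involutive : ∀ l → generator l ·W generator l ≈W εW
  generator-involutive l with view l
  ... | ‵fromℕ = (λ _ → refl) , (λ _ → refl) , refl
  ... | ‵inj₁ ‵fromℕ = transpose-involutive (inject₁ top) last , (λ _ → refl) , refl
  ... | ‵inj₁ (‵inject₁ j) = transpose-involutive _ _ , transpose-involutive _ _ , refl

  generator-nontrivial : ∀ l → ¬ (generator l ≈W εW)
  generator-nontrivial l with view l
  ... | ‵fromℕ = λ { (_ , _ , ()) }
  ... | ‵inj₁ ‵fromℕ = λ (moves≈id , _) → adjacent-moves top (moves≈id (inject₁ top))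
  ... | ‵inj₁ (‵inject₁ j) = λ (moves≈id , _) → adjacent-moves (inject₁ j) (moves≈id (inject₁ (inject₁ j)))

  private
    toℕ-top′ : toℕ (inject₁ top) ≡ suc k
    toℕ-top′ = trans (toℕ-inject₁ top) toℕ-top

    indices : ∀ {a b : Fin m} → NonAdjacent (toℕ (inject₁ a)) (toℕ (inject₁ b)) → NonAdjacent (toℕ a) (toℕ b)
    indices {a} {b} = subst₂ NonAdjacent (toℕ-inject₁ a) (toℕ-inject₁ b)

  generators-commute : ∀ i j → NonAdjacent (toℕ i) (toℕ j) → generator j ·W generator i ≈W generator i ·W generator j
  generators-commute i j far with view i | view j
  ... | ‵fromℕ | ‵fromℕ = ⊥-elim (proj₁ far refl)
  ... | ‵fromℕ | ‵inj₁ ‵fromℕ = ⊥-elim (proj₁ (proj₂ far) (trans (toℕ-fromℕ m) (cong suc (sym toℕ-top′))))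
  ... | ‵fromℕ | ‵inj₁ (‵inject₁ _) = (λ _ → refl) , (λ _ → refl) , refl
  ... | ‵inj₁ ‵fromℕ | ‵fromℕ = ⊥-elim (proj₂ (proj₂ far) (trans (cong suc toℕ-top′) (sym (toℕ-fromℕ m))))
  ... | ‵inj₁ ‵fromℕ | ‵inj₁ ‵fromℕ = ⊥-elim (proj₁ far refl)
  ... | ‵inj₁ ‵fromℕ | ‵inj₁ (‵inject₁ _) = adjacent-comm (indices far) , (λ _ → refl) , refl
  ... | ‵inj₁ (‵inject₁ _) | ‵fromℕ = (λ _ → refl) , (λ _ → refl) , refl
  ... | ‵inj₁ (‵inject₁ _) | ‵inj₁ ‵fromℕ = adjacent-comm (indices far) , (λ _ → refl) , refl
  ... | ‵inj₁ (‵inject₁ _) | ‵inj₁ (‵inject₁ _) = adjacent-comm (indices far) , adjacent-comm (indices far) , refl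

  ρ-ρ : ∀ i j z → ρ j ⟨$⟩ʳ (ρ i ⟨$⟩ʳ z) ≡ φ (generator i ·W generator j) ⟨$⟩ʳ z
  ρ-ρ i j z = begin
    ρ j ⟨$⟩ʳ (ρ i ⟨$⟩ʳ z)                         ≡⟨ cong (ρ j ⟨$⟩ʳ_) (ρ≈φ-generator i z) ⟩
    ρ j ⟨$⟩ʳ (φ (generator i) ⟨$⟩ʳ z)             ≡⟨ ρ≈φ-generator j _ ⟩
    φ (generator j) ⟨$⟩ʳ (φ (generator i) ⟨$⟩ʳ z) ≡⟨ φ-hom (generator i) (generator j) z ⟨
    φ (generator i ·W generator j) ⟨$⟩ʳ z         ∎
    where open ≡-Reasoning

  ρ-involutive : ∀ l z → ρ l ⟨$⟩ʳ (ρ l ⟨$⟩ʳ z) ≡ z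
  ρ-involutive l z = trans (ρ-ρ l l z) (trans (φ-cong (generator-involutive l) z) (φ-ε z))

  ρ-isInvolution : ∀ l → IsInvolution (ρ l)
  ρ-isInvolution l = ρ-involutive l , λ ρ≈id →
    generator-nontrivial l (φ-injective (generator l) εW (λ z → trans (sym (ρ≈φ-generator l z)) (trans (ρ≈id z) (sym (φ-ε z)))))

  ρ-comm : ∀ i j → NonAdjacent (toℕ i) (toℕ j) → ∀ z → ρ j ⟨$⟩ʳ (ρ i ⟨$⟩ʳ z) ≡ ρ i ⟨$⟩ʳ (ρ j ⟨$⟩ʳ z)
  ρ-comm i j far z = trans (ρ-ρ i j z) (trans (sym (φ-cong (generators-commute i j far) z)) (sym (ρ-ρ j i z)))

  ρ-string : ∀ i j → 2 ≤ (toℕ i ∸ toℕ j) + (toℕ j ∸ toℕ i) → (ρ i ∘ₚ ρ j) ∘ₚ (ρ i ∘ₚ ρ j) ≈ₚ idₚ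
  ρ-string i j 2≤dist z = begin
    ρ j ⟨$⟩ʳ (ρ i ⟨$⟩ʳ (ρ j ⟨$⟩ʳ (ρ i ⟨$⟩ʳ z))) ≡⟨ cong (ρ j ⟨$⟩ʳ_) (ρ-comm i j far (ρ i ⟨$⟩ʳ z)) ⟨
    ρ j ⟨$⟩ʳ (ρ j ⟨$⟩ʳ (ρ i ⟨$⟩ʳ (ρ i ⟨$⟩ʳ z))) ≡⟨ ρ-involutive j _ ⟩
    ρ i ⟨$⟩ʳ (ρ i ⟨$⟩ʳ z)                       ≡⟨ ρ-involutive i z ⟩
    z                                           ∎
    where
    open ≡-Reasoning
    far : NonAdjacent (toℕ i) (toℕ j)
    far = nonAdjacent (toℕ i) (toℕ j) 2≤dist

  ρ-intersection : ∀ I J π → ⟨ ρ ∣ I ⟩∋ π × ⟨ ρ ∣ J ⟩∋ π → ⟨ ρ ∣ I ∩ J ⟩∋ π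
  ρ-intersection I J π (π∈I , π∈J) with parabolic-sound I π∈I | parabolic-sound J π∈J
  ... | x , φx≈π , x-parabolic | y , φy≈π , y-parabolic =
    gen-ext φx≈π (φ∈ (parabolic-complete (I ∩ J) x (parabolic-∩ I J x x-parabolic x-parabolicᴶ)))
    where
    y≈x : y ≈W x
    y≈x = φ-injective y x (λ z → trans (φy≈π z) (sym (φx≈π z)))
    x-parabolicᴶ : Parabolic J x
    x-parabolicᴶ = parabolic-≈ J {y} {x} y≈x y-parabolic

  isStringCGroup : IsStringCGroup ρ
  isStringCGroup = record
    { involutions   = ρ-isInvolution
    ; string        = ρ-string
    ; intersection  = ρ-intersection
    ; intersection⁻ = λ I J π π∈I∩J → ⟨⟩∋-mono (p∩q⊆p I J) π∈I∩J , ⟨⟩∋-mono (p∩q⊆q I J) π∈I∩J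
    }

  wreathIso : WreathIso r ρ
  wreathIso = record
    { φ        = φ
    ; φ-into   = λ x → φ∈ (parabolic-complete ⊤ x (parabolic-⊤ x))
    ; φ-hom    = φ-hom
    ; φ-inj    = φ-injective
    ; φ-onto   = λ π π∈ → let (x , φx≈π , _) = parabolic-sound ⊤ π∈ in x , φx≈π
    }

lemma4p9 : (r : ℕ) → 3 ≤ r →
    IsCPRGraph (𝒢 r) × WreathIso r (edgeInvolution (𝒢 r))
lemma4p9 (suc (suc (suc k))) (s≤s (s≤s (s≤s z≤n))) = isStringCGroup k , wreathIso k
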